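{- Let $n\geq 4$ and let $B=\operatorname{circ}(3,1,0,\ldots,0,1)$ of order $n-1$. Let \[Q=\left[\begin{array}{c|c} n-1 & \mathbf{1}^T \\ \hline \mathbf{1} & B \end{array}\right]\] (the signless Laplacian matrix of the wheel graph $W_n$, with the hub as the first vertex). Let $C=\operatorname{circ}(1,0,\ldots,0,1)$ of order $n-1$. Then the Moore–Penrose inverse of $Q$ is \[Q^+=\frac{1}{4(n-1)} \left[\begin{array}{r|c} 5 & -\mathbf{1}^T \\ \hline -\mathbf{1} & J_{n-1}+2X \end{array}\right],\] where $X=2(CC^T+I_{n-1})^{ -1}\left[ (n-1)I_{n-1}-J_{n-1}\right]=\operatorname{circ}(b_0,b_1,\ldots,b_{n-2})$ with, for $j=0,\ldots,n-2$, \[b_j=-\frac{2}{5}+\frac{2^{n-j}(n-1)}{\sqrt{5}}\left[\frac{(-3+\sqrt{5})^j}{2^{n-1}-(-3+\sqrt{5})^{n-1}}-\frac{(-3-\sqrt{5})^j}{2^{n-1}-(-3-\sqrt{5})^{n-1}}\right].\]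
   Context: For real numbers $c_0,\ldots,c_{k-1}$, $\operatorname{circ}(c_0,c_1,\ldots,c_{k-1})$ denotes the $k\times k$ circulant matrix whose $(i,j)$-entry is $c_{(j-i)\bmod k}$. $\mathbf{1}$ is the all-ones column vector of length $n-1$, $I_k$ the $k\times k$ identity and $J_k$ the $k\times k$ all-ones matrix. The wheel graph $W_n$ is obtained from a cycle on $n-1$ vertices by adding a vertex adjacent to all of them; its signless Laplacian is $D+A$ (degree matrix plus adjacency matrix). The Moore–Penrose inverse of a real matrix $A$ is the unique matrix $A^+$ with $AA^+A=A$, $A^+AA^+=A^+$, $(AA^+)^T=AA^+$, $(A^+A)^T=A^+A$. -}

module Defs where

open import Data.Nat as ℕ using (ℕ; zero; suc; _∸_)
open import Data.Nat.DivMod using (_mod_)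
open import Data.Integer as ℤ using (ℤ; +_)
open import Data.Rational as Q using (ℚ; 0ℚ; 1ℚ)
open import Data.Rational.Properties as QP using ()
open import Data.Fin using (Fin; toℕ)
import Data.Fin as F
open import Data.Product using (_×_; Σ-syntax)
open import Relation.Nullary using (yes; no)
open import Relation.Binary.PropositionalEquality using (_≡_)

-- The real quadratic field ℚ(√5) ⊂ ℝ : elements a + b√5 with a b ∈ ℚ.
-- All numbers occurring in the statement lie in this subfield of ℝ.

record ℚ√5 : Set where
  constructor _+_√5
  field
    re : ℚ
    ir : ℚ
open ℚ√5 public

infixl 6 _⊕_ _⊖_
infixl 7 _⊛_ _⊘_

_⊕_ : ℚ√5 → ℚ√5 → ℚ√5
(a + b √5) ⊕ (c + d √5) = (a Q.+ c) + (b Q.+ d) √5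

⊝_ : ℚ√5 → ℚ√5
⊝ (a + b √5) = (Q.- a) + (Q.- b) √5

_⊖_ : ℚ√5 → ℚ√5 → ℚ√5
x ⊖ y = x ⊕ (⊝ y)

_⊛_ : ℚ√5 → ℚ√5 → ℚ√5
(a + b √5) ⊛ (c + d √5) =
  ((a Q.* c) Q.+ ((+ 5) Q./ 1) Q.* (b Q.* d)) + ((a Q.* d) Q.+ (b Q.* c)) √5

-- multiplicative inverse (a + b√5)⁻¹ = (a - b√5)/(a² - 5b²); by convention 0⁻¹ = 0
-- (the norm a² - 5b² vanishes only at 0 since √5 is irrational).
inv : ℚ√5 → ℚ√5
inv (a + b √5) with (a Q.* a) Q.- ((+ 5) Q./ 1) Q.* (b Q.* b) QP.≟ 0ℚ
... | yes _ = 0ℚ + 0ℚ √5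
... | no N≢0 = let instance _ = Q.≢-nonZero N≢0 in
               (a Q.÷ N) + ((Q.- b) Q.÷ N) √5
  where N = (a Q.* a) Q.- ((+ 5) Q./ 1) Q.* (b Q.* b)

_⊘_ : ℚ√5 → ℚ√5 → ℚ√5
x ⊘ y = x ⊛ inv y

⟦_⟧ : ℕ → ℚ√5
⟦ n ⟧ = ((+ n) Q./ 1) + 0ℚ √5

𝟘 𝟙 : ℚ√5
𝟘 = ⟦ 0 ⟧
𝟙 = ⟦ 1 ⟧

√5 : ℚ√5
√5 = 0ℚ + 1ℚ √5

_^_ : ℚ√5 → ℕ → ℚ√5
x ^ zero  = 𝟙
x ^ suc n = x ⊛ (x ^ n)

infix 4 _≋_
infixl 7 _·_
infixl 6 _⊞_ _⊟_
infixr 8 _•_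
infixl 9 _ᵀ
infixr 10 _^_

Mat : ℕ → ℕ → Set
Mat m n = Fin m → Fin n → ℚ√5

_≋_ : ∀ {m n} → Mat m n → Mat m n → Set
A ≋ B = ∀ i j → A i j ≡ B i j

∑ : ∀ {n} → (Fin n → ℚ√5) → ℚ√5
∑ {zero}  f = 𝟘
∑ {suc n} f = f F.zero ⊕ ∑ (λ i → f (F.suc i))

_·_ : ∀ {m n p} → Mat m n → Mat n p → Mat m p
(A · B) i j = ∑ (λ l → A i l ⊛ B l j)

_ᵀ : ∀ {m n} → Mat m n → Mat n m
(A ᵀ) i j = A j i

_⊞_ _⊟_ : ∀ {m n} → Mat m n → Mat m n → Mat m n
(A ⊞ B) i j = A i j ⊕ B i j
(A ⊟ B) i j = A i j ⊖ B i j

_•_ : ∀ {m n} → ℚ√5 → Mat m n → Mat m n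
(c • A) i j = c ⊛ A i j

Id : ∀ n → Mat n n
Id n i j with toℕ i ℕ.≟ toℕ j
... | yes _ = 𝟙
... | no  _ = 𝟘

J : ∀ n → Mat n n
J n i j = 𝟙

-- circ(c₀,…,c_{k-1}) : (i,j)-entry is c_{(j-i) mod k}
circ : ∀ k → (Fin k → ℚ√5) → Mat k k
circ zero    c ()
circ (suc k) c i j = c ((toℕ j ℕ.+ (suc k ∸ toℕ i)) mod suc k)

block : ∀ {k} → ℚ√5 → (Fin k → ℚ√5) → (Fin k → ℚ√5) → Mat k k → Mat (suc k) (suc k)
block a r c B F.zero    F.zero    = a
block a r c B F.zero    (F.suc j) = r j
block a r c B (F.suc i) F.zero    = c i
block a r c B (F.suc i) (F.suc j) = B i j

-- Moore–Penrose (Penrose) equations: G is the Moore–Penrose inverse of A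
-- (the unique matrix satisfying these four equations; transpose = conjugate transpose over ℝ).
IsMoorePenroseInverse : ∀ {m n} → Mat m n → Mat n m → Set
IsMoorePenroseInverse A G =
  ((A · G) · A ≋ A) × ((G · A) · G ≋ G) ×
  (((A · G) ᵀ) ≋ (A · G)) × (((G · A) ᵀ) ≋ (G · A))

IsInverse : ∀ {n} → Mat n n → Mat n n → Set
IsInverse A Y = (A · Y ≋ Id _) × (Y · A ≋ Id _)

-- Data of the theorem; k = n - 1 is the order of the circulant blocks.

cB : ∀ k → Fin k → ℚ√5
cB k i with toℕ i ℕ.≟ 0
... | yes _ = ⟦ 3 ⟧
... | no _ with toℕ i ℕ.≟ 1
...   | yes _ = 𝟙
...   | no _ with toℕ i ℕ.≟ (k ∸ 1)
...     | yes _ = 𝟙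
...     | no _  = 𝟘

cC : ∀ k → Fin k → ℚ√5
cC k i with toℕ i ℕ.≟ 0
... | yes _ = 𝟙
... | no _ with toℕ i ℕ.≟ (k ∸ 1)
...   | yes _ = 𝟙
...   | no _  = 𝟘

ones : ∀ k → Fin k → ℚ√5
ones k _ = 𝟙

Qmat : ∀ k → Mat (suc k) (suc k)
Qmat k = block ⟦ k ⟧ (ones k) (ones k) (circ k (cB k))

bcoef : ∀ k → Fin k → ℚ√5
bcoef k j' =
  (⊝ (⟦ 2 ⟧ ⊘ ⟦ 5 ⟧)) ⊕
  ((⟦ 2 ⟧ ^ (n ∸ j)) ⊛ ⟦ n ∸ 1 ⟧ ⊘ √5) ⊛
    ( ((α ^ j) ⊘ ((⟦ 2 ⟧ ^ (n ∸ 1)) ⊖ (α ^ (n ∸ 1))))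
    ⊖ ((β ^ j) ⊘ ((⟦ 2 ⟧ ^ (n ∸ 1)) ⊖ (β ^ (n ∸ 1)))) )
  where
    n = suc k
    j = toℕ j'
    α = (⊝ ⟦ 3 ⟧) ⊕ √5
    β = (⊝ ⟦ 3 ⟧) ⊖ √5

Qplus : ∀ k → Mat (suc k) (suc k)
Qplus k = (𝟙 ⊘ (⟦ 4 ⟧ ⊛ ⟦ k ⟧)) •
  block ⟦ 5 ⟧ (λ _ → ⊝ 𝟙) (λ _ → ⊝ 𝟙) (J k ⊞ (⟦ 2 ⟧ • circ k (bcoef k)))

-- Q is invertible, so its Moore–Penrose inverse is its inverse, and since C Cᵀ + I = B everything
-- reduces to identities for the circulant B = circ(3,1,0,…,0,1).  The numbers b_j satisfy the cyclic
-- recurrence b_{j-1} + 3 b_j + b_{j+1} = 2k [j = 0] - 2, i.e. B X = X B = 2k I - 2J: the geometric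
-- parts 2^{-j} α^j, 2^{-j} β^j solve the homogeneous recurrence because α/2, β/2 are the roots of
-- x² + 3x + 1, and the denominators 2^k - α^k, 2^k - β^k (nonzero, as their norm 2^{k+1} (2^k - p_k)
-- is) make the solution k-periodic with the jump 2k at j = 0.  As B has line sums 5, X has line
-- sums 0; hence B⁻¹ = (X + (2/5) J) / (2k), and the block products Q Q⁺ and Q⁺ Q are the identity.
-- All entries lie in ℚ(√5), where these identities are checked exactly.
module Submission where

open import Defs
open import Data.Nat using (ℕ; suc; _≤_; s≤s; z≤n)
open import Data.Product using (_×_; Σ-syntax; _,_)

module QuadraticField where
  open import Data.Empty using (⊥-elim)
  open import Data.Integer as ℤ using (ℤ; +_; -[1+_])
  import Data.Integer.Properties as ℤP
  open import Data.Nat as ℕ using (ℕ; zero; suc)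
  import Data.Nat.Coprimality as Coprimality
  open import Data.Rational as Q using (ℚ; 0ℚ; 1ℚ; mkℚ)
  import Data.Rational.Properties as QP
  open import Data.Rational.Solver using (module +-*-Solver)
  open import Algebra.Structures using (IsCommutativeMonoid)
  open import Algebra.Structures.Biased using (IsCommutativeSemiringʳ; IsCommutativeMonoidˡ)
  open import Algebra.Solver.Ring.AlmostCommutativeRing using (AlmostCommutativeRing)
  import Algebra.Solver.Ring.Simple as SimpleRingSolver
  open import Relation.Binary.Definitions using (DecidableEquality)
  open import Relation.Binary.PropositionalEquality
  open import Relation.Nullary using (yes; no)

  open +-*-Solver using (solve; _:=_; con; _:+_; _:*_; :-_; _:-_)

  +√5-cong : ∀ {a b c d} → a ≡ c → b ≡ d → a + b √5 ≡ c + d √5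
  +√5-cong = cong₂ _+_√5

  ⊕-assoc : ∀ x y z → (x ⊕ y) ⊕ z ≡ x ⊕ (y ⊕ z)
  ⊕-assoc (a + b √5) (c + d √5) (e + f √5) = +√5-cong (QP.+-assoc a c e) (QP.+-assoc b d f)

  ⊕-comm : ∀ x y → x ⊕ y ≡ y ⊕ x
  ⊕-comm (a + b √5) (c + d √5) = +√5-cong (QP.+-comm a c) (QP.+-comm b d)

  ⊕-identityˡ : ∀ x → 𝟘 ⊕ x ≡ x
  ⊕-identityˡ (a + b √5) = +√5-cong (QP.+-identityˡ a) (QP.+-identityˡ b)

  private
    five : ℚ
    five = re ⟦ 5 ⟧

  ⊛-assoc : ∀ x y z → (x ⊛ y) ⊛ z ≡ x ⊛ (y ⊛ z)
  ⊛-assoc (a + b √5) (c + d √5) (e + f √5) = +√5-cong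
    (solve 7 (λ a b c d e f F → ((a :* c) :+ F :* (b :* d)) :* e :+ F :* (((a :* d) :+ (b :* c)) :* f)
                             := a :* ((c :* e) :+ F :* (d :* f)) :+ F :* (b :* ((c :* f) :+ (d :* e))))
           refl a b c d e f five)
    (solve 7 (λ a b c d e f F → ((a :* c) :+ F :* (b :* d)) :* f :+ ((a :* d) :+ (b :* c)) :* e
                             := a :* ((c :* f) :+ (d :* e)) :+ b :* ((c :* e) :+ F :* (d :* f)))
           refl a b c d e f five)

  ⊛-comm : ∀ x y → x ⊛ y ≡ y ⊛ x
  ⊛-comm (a + b √5) (c + d √5) = +√5-cong
    (solve 5 (λ a b c d F → (a :* c) :+ F :* (b :* d) := (c :* a) :+ F :* (d :* b)) refl a b c d five)
    (solve 4 (λ a b c d → (a :* d) :+ (b :* c) := (c :* b) :+ (d :* a)) refl a b c d)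

  ⊛-identityˡ : ∀ x → 𝟙 ⊛ x ≡ x
  ⊛-identityˡ (a + b √5) = +√5-cong
    (solve 3 (λ a b F → (con 1ℚ :* a) :+ F :* (con 0ℚ :* b) := a) refl a b five)
    (solve 2 (λ a b → (con 1ℚ :* b) :+ (con 0ℚ :* a) := b) refl a b)

  ⊛-distribˡ-⊕ : ∀ x y z → x ⊛ (y ⊕ z) ≡ (x ⊛ y) ⊕ (x ⊛ z)
  ⊛-distribˡ-⊕ (a + b √5) (c + d √5) (e + f √5) = +√5-cong
    (solve 7 (λ a b c d e f F → a :* (c :+ e) :+ F :* (b :* (d :+ f))
                             := ((a :* c) :+ F :* (b :* d)) :+ ((a :* e) :+ F :* (b :* f)))
           refl a b c d e f five)
    (solve 6 (λ a b c d e f → a :* (d :+ f) :+ b :* (c :+ e)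
                           := ((a :* d) :+ (b :* c)) :+ ((a :* f) :+ (b :* e)))
           refl a b c d e f)

  ⊛-zeroʳ : ∀ x → x ⊛ 𝟘 ≡ 𝟘
  ⊛-zeroʳ (a + b √5) = +√5-cong
    (solve 3 (λ a b F → (a :* con 0ℚ) :+ F :* (b :* con 0ℚ) := con 0ℚ) refl a b five)
    (solve 2 (λ a b → (a :* con 0ℚ) :+ (b :* con 0ℚ) := con 0ℚ) refl a b)

  ⊝-distribˡ-⊛ : ∀ x y → (⊝ x) ⊛ y ≡ ⊝ (x ⊛ y)
  ⊝-distribˡ-⊛ (a + b √5) (c + d √5) = +√5-cong
    (solve 5 (λ a b c d F → ((:- a) :* c) :+ F :* ((:- b) :* d) := :- ((a :* c) :+ F :* (b :* d)))
           refl a b c d five)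
    (solve 4 (λ a b c d → ((:- a) :* d) :+ ((:- b) :* c) := :- ((a :* d) :+ (b :* c))) refl a b c d)

  ⊝-⊕-comm : ∀ x y → (⊝ x) ⊕ (⊝ y) ≡ ⊝ (x ⊕ y)
  ⊝-⊕-comm (a + b √5) (c + d √5) = +√5-cong (sym (QP.neg-distrib-+ a c)) (sym (QP.neg-distrib-+ b d))

  _≟_ : DecidableEquality ℚ√5
  (a + b √5) ≟ (c + d √5) with a QP.≟ c | b QP.≟ d
  ... | yes refl | yes refl = yes refl
  ... | no a≢c   | _        = no λ { refl → a≢c refl }
  ... | _        | no b≢d   = no λ { refl → b≢d refl }

  almostCommutativeRing : AlmostCommutativeRing _ _
  almostCommutativeRing = record
    { Carrier = ℚ√5 ; _≈_ = _≡_ ; _+_ = _⊕_ ; _*_ = _⊛_ ; -_ = ⊝_ ; 0# = 𝟘 ; 1# = 𝟙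
    ; isAlmostCommutativeRing = record
      { isCommutativeSemiring = IsCommutativeSemiringʳ.isCommutativeSemiring (record
          { +-isCommutativeMonoid = commutativeMonoid _⊕_ ⊕-assoc ⊕-identityˡ ⊕-comm
          ; *-isCommutativeMonoid = commutativeMonoid _⊛_ ⊛-assoc ⊛-identityˡ ⊛-comm
          ; distribˡ = ⊛-distribˡ-⊕
          ; zeroʳ = ⊛-zeroʳ })
      ; -‿cong = cong ⊝_
      ; -‿*-distribˡ = ⊝-distribˡ-⊛
      ; -‿+-comm = ⊝-⊕-comm } }
    where
    commutativeMonoid : ∀ _∙_ {ε} → (∀ x y z → (x ∙ y) ∙ z ≡ x ∙ (y ∙ z)) →
                        (∀ x → ε ∙ x ≡ x) → (∀ x y → x ∙ y ≡ y ∙ x) → IsCommutativeMonoid _≡_ _∙_ ε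
    commutativeMonoid _∙_ assoc identityˡ comm = IsCommutativeMonoidˡ.isCommutativeMonoid (record
      { isSemigroup = record
        { isMagma = record { isEquivalence = isEquivalence ; ∙-cong = cong₂ _∙_ } ; assoc = assoc }
      ; identityˡ = identityˡ ; comm = comm })

  module ℚ√5-Solver = SimpleRingSolver almostCommutativeRing _≟_

  fromℤ : ℤ → ℚ
  fromℤ z = z Q./ 1

  fromℤ≡mkℚ : ∀ z → fromℤ z ≡ mkℚ z 0 (Coprimality.sym (Coprimality.1-coprimeTo _))
  fromℤ≡mkℚ (+ n)    = QP.normalize-coprime {n} {0} (Coprimality.sym (Coprimality.1-coprimeTo _))
  fromℤ≡mkℚ -[1+ n ] = cong Q.-_ (QP.normalize-coprime {suc n} {0} (Coprimality.sym (Coprimality.1-coprimeTo _)))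

  ↥-fromℤ : ∀ z → Q.↥ fromℤ z ≡ z
  ↥-fromℤ z = cong Q.↥_ (fromℤ≡mkℚ z)

  fromℤ-+ : ∀ a b → fromℤ a Q.+ fromℤ b ≡ fromℤ (a ℤ.+ b)
  fromℤ-+ a b rewrite fromℤ≡mkℚ a | fromℤ≡mkℚ b =
    cong fromℤ (cong₂ ℤ._+_ (ℤP.*-identityʳ a) (ℤP.*-identityʳ b))

  fromℤ-* : ∀ a b → fromℤ a Q.* fromℤ b ≡ fromℤ (a ℤ.* b)
  fromℤ-* a b rewrite fromℤ≡mkℚ a | fromℤ≡mkℚ b = refl

  fromℤ-neg : ∀ a → Q.- fromℤ a ≡ fromℤ (ℤ.- a)
  fromℤ-neg a rewrite fromℤ≡mkℚ a | fromℤ≡mkℚ (ℤ.- a) = neg-mkℚ a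
    where
    neg-mkℚ : ∀ a → Q.- mkℚ a 0 (Coprimality.sym (Coprimality.1-coprimeTo _))
                  ≡ mkℚ (ℤ.- a) 0 (Coprimality.sym (Coprimality.1-coprimeTo _))
    neg-mkℚ (+ zero)  = refl
    neg-mkℚ (+ suc n) = refl
    neg-mkℚ -[1+ n ]  = refl

  ⟦⟧-+ : ∀ m n → ⟦ m ℕ.+ n ⟧ ≡ ⟦ m ⟧ ⊕ ⟦ n ⟧
  ⟦⟧-+ m n = +√5-cong (trans (cong fromℤ (ℤP.pos-+ m n)) (sym (fromℤ-+ (+ m) (+ n)))) refl

  ⟦⟧-* : ∀ m n → ⟦ m ℕ.* n ⟧ ≡ ⟦ m ⟧ ⊛ ⟦ n ⟧
  ⟦⟧-* m n = +√5-cong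
    (trans (cong fromℤ (ℤP.pos-* m n)) (trans (sym (fromℤ-* (+ m) (+ n))) (sym (QP.+-identityʳ _))))
    (sym (cong₂ Q._+_ (QP.*-zeroʳ (fromℤ (+ m))) (QP.*-zeroˡ (fromℤ (+ n)))))

  ⟦⟧-^ : ∀ m j → ⟦ m ⟧ ^ j ≡ ⟦ m ℕ.^ j ⟧
  ⟦⟧-^ m zero    = refl
  ⟦⟧-^ m (suc j) = trans (cong (⟦ m ⟧ ⊛_) (⟦⟧-^ m j)) (sym (⟦⟧-* m (m ℕ.^ j)))

  fromℤ-⊛ : ∀ a b c d → (fromℤ a + fromℤ b √5) ⊛ (fromℤ c + fromℤ d √5)
                      ≡ fromℤ ((a ℤ.* c) ℤ.+ (+ 5) ℤ.* (b ℤ.* d)) + fromℤ ((a ℤ.* d) ℤ.+ (b ℤ.* c)) √5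
  fromℤ-⊛ a b c d = +√5-cong
    (trans (cong₂ Q._+_ (fromℤ-* a c) (trans (cong (fromℤ (+ 5) Q.*_) (fromℤ-* b d)) (fromℤ-* (+ 5) (b ℤ.* d))))
           (fromℤ-+ (a ℤ.* c) ((+ 5) ℤ.* (b ℤ.* d))))
    (trans (cong₂ Q._+_ (fromℤ-* a d) (fromℤ-* b c)) (fromℤ-+ (a ℤ.* d) (b ℤ.* c)))

  norm : ℚ√5 → ℚ
  norm (a + b √5) = (a Q.* a) Q.- five Q.* (b Q.* b)

  ⊛-inverseʳ : ∀ x → norm x ≢ 0ℚ → x ⊛ inv x ≡ 𝟙
  ⊛-inverseʳ (a + b √5) norm≢0 with (a Q.* a) Q.- five Q.* (b Q.* b) QP.≟ 0ℚ
  ... | yes norm≡0 = ⊥-elim (norm≢0 norm≡0)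
  ... | no N≢0 = +√5-cong
    (trans (solve 4 (λ a b F i → a :* (a :* i) :+ F :* (b :* ((:- b) :* i)) := ((a :* a) :- F :* (b :* b)) :* i)
                  refl a b five (Q.1/ N))
           (QP.*-inverseʳ N))
    (solve 3 (λ a b i → a :* ((:- b) :* i) :+ b :* (a :* i) := con 0ℚ) refl a b (Q.1/ N))
    where
    N = (a Q.* a) Q.- five Q.* (b Q.* b)
    instance _ = Q.≢-nonZero N≢0

  norm-fromℤ : ∀ a b → norm (fromℤ a + fromℤ b √5) ≡ fromℤ ((a ℤ.* a) ℤ.- (+ 5) ℤ.* (b ℤ.* b))
  norm-fromℤ a b = begin
    fromℤ a Q.* fromℤ a Q.- fromℤ (+ 5) Q.* (fromℤ b Q.* fromℤ b)
      ≡⟨ cong₂ (λ u v → u Q.- fromℤ (+ 5) Q.* v) (fromℤ-* a a) (fromℤ-* b b) ⟩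
    fromℤ (a ℤ.* a) Q.- fromℤ (+ 5) Q.* fromℤ (b ℤ.* b)
      ≡⟨ cong (λ u → fromℤ (a ℤ.* a) Q.- u) (fromℤ-* (+ 5) (b ℤ.* b)) ⟩
    fromℤ (a ℤ.* a) Q.+ Q.- fromℤ ((+ 5) ℤ.* (b ℤ.* b))
      ≡⟨ cong (fromℤ (a ℤ.* a) Q.+_) (fromℤ-neg ((+ 5) ℤ.* (b ℤ.* b))) ⟩
    fromℤ (a ℤ.* a) Q.+ fromℤ (ℤ.- ((+ 5) ℤ.* (b ℤ.* b)))
      ≡⟨ fromℤ-+ (a ℤ.* a) (ℤ.- ((+ 5) ℤ.* (b ℤ.* b))) ⟩
    fromℤ ((a ℤ.* a) ℤ.- (+ 5) ℤ.* (b ℤ.* b)) ∎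
    where open ≡-Reasoning

  integral-⊛-inverseʳ : ∀ a b → (a ℤ.* a) ℤ.- (+ 5) ℤ.* (b ℤ.* b) ≢ + 0 →
                        (fromℤ a + fromℤ b √5) ⊛ inv (fromℤ a + fromℤ b √5) ≡ 𝟙
  integral-⊛-inverseʳ a b N≢0 = ⊛-inverseʳ (fromℤ a + fromℤ b √5) λ norm≡0 →
    N≢0 (trans (sym (↥-fromℤ _)) (cong Q.↥_ (trans (sym (norm-fromℤ a b)) norm≡0)))

  ⟦suc⟧-⊛-inverseʳ : ∀ n → ⟦ suc n ⟧ ⊛ inv ⟦ suc n ⟧ ≡ 𝟙
  ⟦suc⟧-⊛-inverseʳ n = integral-⊛-inverseʳ (+ suc n) (+ 0) λ ()

module FiniteSums where
  open import Data.Empty using (⊥-elim)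
  open import Data.Fin as F using (Fin; toℕ)
  import Data.Fin.Properties as FP
  open import Data.Nat as ℕ using (ℕ; zero; suc)
  open import Data.Product using (_,_)
  open import Function using (_∘_)
  open import Relation.Binary.PropositionalEquality hiding (J)
  open import Relation.Nullary using (yes; no)
  open QuadraticField
  open ℚ√5-Solver using (solve; _:=_; con; _:+_; _:*_)

  ∑-cong : ∀ {n} {f g : Fin n → ℚ√5} → (∀ i → f i ≡ g i) → ∑ f ≡ ∑ g
  ∑-cong {zero}  f≡g = refl
  ∑-cong {suc n} f≡g = cong₂ _⊕_ (f≡g F.zero) (∑-cong (λ i → f≡g (F.suc i)))

  ∑-distrib-⊕ : ∀ {n} (f g : Fin n → ℚ√5) → ∑ (λ i → f i ⊕ g i) ≡ ∑ f ⊕ ∑ g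
  ∑-distrib-⊕ {zero}  f g = refl
  ∑-distrib-⊕ {suc n} f g rewrite ∑-distrib-⊕ (λ i → f (F.suc i)) (λ i → g (F.suc i)) =
    solve 4 (λ a b c d → (a :+ b) :+ (c :+ d) := (a :+ c) :+ (b :+ d)) refl (f F.zero) (g F.zero) _ _

  ∑-⊛ˡ : ∀ {n} (c : ℚ√5) (f : Fin n → ℚ√5) → ∑ (λ i → c ⊛ f i) ≡ c ⊛ ∑ f
  ∑-⊛ˡ {zero}  c f = sym (⊛-zeroʳ c)
  ∑-⊛ˡ {suc n} c f rewrite ∑-⊛ˡ c (λ i → f (F.suc i)) = sym (⊛-distribˡ-⊕ c _ _)

  ∑-⊛ʳ : ∀ {n} (c : ℚ√5) (f : Fin n → ℚ√5) → ∑ (λ i → f i ⊛ c) ≡ ∑ f ⊛ c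
  ∑-⊛ʳ c f = trans (∑-cong (λ i → ⊛-comm (f i) c)) (trans (∑-⊛ˡ c f) (⊛-comm c (∑ f)))

  ∑-𝟘 : ∀ {n} (f : Fin n → ℚ√5) → (∀ i → f i ≡ 𝟘) → ∑ f ≡ 𝟘
  ∑-𝟘 {zero}  f f≡𝟘 = refl
  ∑-𝟘 {suc n} f f≡𝟘 rewrite f≡𝟘 F.zero | ∑-𝟘 (λ i → f (F.suc i)) (λ i → f≡𝟘 (F.suc i)) = refl

  ∑-const : ∀ n (c : ℚ√5) → ∑ {n} (λ _ → c) ≡ ⟦ n ⟧ ⊛ c
  ∑-const zero    c = solve 1 (λ x → con 𝟘 := con 𝟘 :* x) refl c
  ∑-const (suc n) c = begin
    c ⊕ ∑ {n} (λ _ → c) ≡⟨ cong (c ⊕_) (∑-const n c) ⟩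
    c ⊕ ⟦ n ⟧ ⊛ c       ≡⟨ solve 2 (λ c x → c :+ x :* c := (con 𝟙 :+ x) :* c) refl c ⟦ n ⟧ ⟩
    (𝟙 ⊕ ⟦ n ⟧) ⊛ c     ≡⟨ cong (_⊛ c) (sym (⟦⟧-+ 1 n)) ⟩
    ⟦ suc n ⟧ ⊛ c       ∎
    where open ≡-Reasoning

  ∑-comm : ∀ {m n} (f : Fin m → Fin n → ℚ√5) → ∑ (λ i → ∑ (λ j → f i j)) ≡ ∑ (λ j → ∑ (λ i → f i j))
  ∑-comm {zero}  f = sym (∑-𝟘 _ (λ j → refl))
  ∑-comm {suc m} f = begin
    ∑ (λ j → f F.zero j) ⊕ ∑ (λ i → ∑ (λ j → f (F.suc i) j))
      ≡⟨ cong (∑ (λ j → f F.zero j) ⊕_) (∑-comm (λ i j → f (F.suc i) j)) ⟩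
    ∑ (λ j → f F.zero j) ⊕ ∑ (λ j → ∑ (λ i → f (F.suc i) j))
      ≡⟨ sym (∑-distrib-⊕ _ _) ⟩
    ∑ (λ j → ∑ (λ i → f i j)) ∎
    where open ≡-Reasoning

  erase : ∀ {n} → Fin n → (Fin n → ℚ√5) → Fin n → ℚ√5
  erase a f i with i FP.≟ a
  ... | yes _ = 𝟘
  ... | no  _ = f i

  erase-≢ : ∀ {n} {a i : Fin n} (f : Fin n → ℚ√5) → i ≢ a → erase a f i ≡ f i
  erase-≢ {a = a} {i} f i≢a with i FP.≟ a
  ... | yes i≡a = ⊥-elim (i≢a i≡a)
  ... | no  _   = refl

  erase-suc : ∀ {n} (a i : Fin n) (f : Fin (suc n) → ℚ√5) →
              erase a (λ i → f (F.suc i)) i ≡ erase (F.suc a) f (F.suc i)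
  erase-suc a i f with i FP.≟ a | F.suc i FP.≟ F.suc a
  ... | yes _   | yes _   = refl
  ... | no  _   | no  _   = refl
  ... | yes i≡a | no  i≢a = ⊥-elim (i≢a (cong F.suc i≡a))
  ... | no  i≢a | yes i≡a = ⊥-elim (i≢a (FP.suc-injective i≡a))

  ∑-erase : ∀ {n} (a : Fin n) (f : Fin n → ℚ√5) → ∑ f ≡ f a ⊕ ∑ (erase a f)
  ∑-erase F.zero f = cong (f F.zero ⊕_) (begin
    ∑ (λ i → f (F.suc i))             ≡⟨ solve 1 (λ x → x := con 𝟘 :+ x) refl (∑ (λ i → f (F.suc i))) ⟩
    𝟘 ⊕ ∑ (λ i → f (F.suc i))         ≡⟨ cong (𝟘 ⊕_) (∑-cong (λ i → sym (erase-≢ {a = F.zero} {F.suc i} f λ ()))) ⟩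
    ∑ (erase F.zero f)                ∎)
    where open ≡-Reasoning
  ∑-erase (F.suc a) f = begin
    f F.zero ⊕ ∑ (λ i → f (F.suc i))
      ≡⟨ cong (f F.zero ⊕_) (∑-erase a (λ i → f (F.suc i))) ⟩
    f F.zero ⊕ (f (F.suc a) ⊕ ∑ (erase a (λ i → f (F.suc i))))
      ≡⟨ cong₂ (λ u v → u ⊕ (f (F.suc a) ⊕ v)) (sym (erase-≢ {a = F.suc a} {F.zero} f λ ())) (∑-cong (λ i → erase-suc a i f)) ⟩
    erase (F.suc a) f F.zero ⊕ (f (F.suc a) ⊕ ∑ (λ i → erase (F.suc a) f (F.suc i)))
      ≡⟨ solve 3 (λ x y z → x :+ (y :+ z) := y :+ (x :+ z)) refl
           (erase (F.suc a) f F.zero) (f (F.suc a)) (∑ (λ i → erase (F.suc a) f (F.suc i))) ⟩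
    f (F.suc a) ⊕ ∑ (erase (F.suc a) f) ∎
    where open ≡-Reasoning

  ∑-support₁ : ∀ {n} (a : Fin n) (f : Fin n → ℚ√5) → (∀ i → i ≢ a → f i ≡ 𝟘) → ∑ f ≡ f a
  ∑-support₁ a f vanish = begin
    ∑ f                  ≡⟨ ∑-erase a f ⟩
    f a ⊕ ∑ (erase a f)  ≡⟨ cong (f a ⊕_) (∑-𝟘 _ erased≡𝟘) ⟩
    f a ⊕ 𝟘              ≡⟨ solve 1 (λ x → x :+ con 𝟘 := x) refl (f a) ⟩
    f a                  ∎
    where
    open ≡-Reasoning
    erased≡𝟘 : ∀ i → erase a f i ≡ 𝟘
    erased≡𝟘 i with i FP.≟ a
    ... | yes _   = refl
    ... | no  i≢a = vanish i i≢a

  ∑-support₃ : ∀ {n} (a b c : Fin n) (f : Fin n → ℚ√5) → a ≢ b → a ≢ c → b ≢ c →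
               (∀ i → i ≢ a → i ≢ b → i ≢ c → f i ≡ 𝟘) → ∑ f ≡ f a ⊕ f b ⊕ f c
  ∑-support₃ a b c f a≢b a≢c b≢c vanish = begin
    ∑ f
      ≡⟨ ∑-erase a f ⟩
    f a ⊕ ∑ (erase a f)
      ≡⟨ cong (f a ⊕_) (∑-erase b (erase a f)) ⟩
    f a ⊕ (erase a f b ⊕ ∑ (erase b (erase a f)))
      ≡⟨ cong₂ (λ u v → f a ⊕ (u ⊕ v)) (erase-≢ f (a≢b ∘ sym)) (∑-support₁ c _ erased≡𝟘) ⟩
    f a ⊕ (f b ⊕ erase b (erase a f) c)
      ≡⟨ cong (λ u → f a ⊕ (f b ⊕ u)) (trans (erase-≢ _ (b≢c ∘ sym)) (erase-≢ f (a≢c ∘ sym))) ⟩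
    f a ⊕ (f b ⊕ f c)
      ≡⟨ sym (⊕-assoc (f a) (f b) (f c)) ⟩
    f a ⊕ f b ⊕ f c ∎
    where
    open ≡-Reasoning
    erased≡𝟘 : ∀ i → i ≢ c → erase b (erase a f) i ≡ 𝟘
    erased≡𝟘 i i≢c with i FP.≟ b
    ... | yes _ = refl
    ... | no i≢b with i FP.≟ a
    ...   | yes _   = refl
    ...   | no  i≢a = vanish i i≢a i≢b i≢c

  Id-≡ : ∀ {n} {i j : Fin n} → i ≡ j → Id n i j ≡ 𝟙
  Id-≡ {i = i} {j} i≡j with toℕ i ℕ.≟ toℕ j
  ... | yes _    = refl
  ... | no  i≢j  = ⊥-elim (i≢j (cong toℕ i≡j))

  Id-≢ : ∀ {n} {i j : Fin n} → i ≢ j → Id n i j ≡ 𝟘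
  Id-≢ {i = i} {j} i≢j with toℕ i ℕ.≟ toℕ j
  ... | yes i≡j = ⊥-elim (i≢j (FP.toℕ-injective i≡j))
  ... | no  _   = refl

  Id-sym : ∀ {n} (i j : Fin n) → Id n i j ≡ Id n j i
  Id-sym i j with i FP.≟ j
  ... | yes i≡j = trans (Id-≡ i≡j) (sym (Id-≡ (sym i≡j)))
  ... | no  i≢j = trans (Id-≢ i≢j) (sym (Id-≢ (i≢j ∘ sym)))

  Id-suc : ∀ {n} (i j : Fin n) → Id (suc n) (F.suc i) (F.suc j) ≡ Id n i j
  Id-suc i j with i FP.≟ j
  ... | yes i≡j = trans (Id-≡ (cong F.suc i≡j)) (sym (Id-≡ i≡j))
  ... | no  i≢j = trans (Id-≢ (i≢j ∘ FP.suc-injective)) (sym (Id-≢ i≢j))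

  ∑-Id-⊛ : ∀ {n} (i : Fin n) (g : Fin n → ℚ√5) → ∑ (λ l → Id n i l ⊛ g l) ≡ g i
  ∑-Id-⊛ {n} i g = begin
    ∑ (λ l → Id n i l ⊛ g l) ≡⟨ ∑-support₁ i _ off-diagonal ⟩
    Id n i i ⊛ g i           ≡⟨ cong (_⊛ g i) (Id-≡ {i = i} refl) ⟩
    𝟙 ⊛ g i                  ≡⟨ ⊛-identityˡ (g i) ⟩
    g i                      ∎
    where
    open ≡-Reasoning
    off-diagonal : ∀ l → l ≢ i → Id n i l ⊛ g l ≡ 𝟘
    off-diagonal l l≢i = trans (cong (_⊛ g l) (Id-≢ (l≢i ∘ sym)))
                               (trans (⊛-comm 𝟘 (g l)) (⊛-zeroʳ (g l)))

  ∑-⊛-Id : ∀ {n} (j : Fin n) (g : Fin n → ℚ√5) → ∑ (λ l → g l ⊛ Id n l j) ≡ g j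
  ∑-⊛-Id {n} j g = trans (∑-cong (λ l → trans (⊛-comm (g l) (Id n l j)) (cong (_⊛ g l) (Id-sym l j))))
                         (∑-Id-⊛ j g)

  ·-identityˡ : ∀ {m n} (A : Mat m n) → Id m · A ≋ A
  ·-identityˡ A i j = ∑-Id-⊛ i (λ l → A l j)

  ·-congˡ : ∀ {m n p} {A A′ : Mat m n} (B : Mat n p) → A ≋ A′ → A · B ≋ A′ · B
  ·-congˡ B A≋A′ i j = ∑-cong (λ l → cong (_⊛ B l j) (A≋A′ i l))

  ·-•ʳ : ∀ {m n p} (A : Mat m n) (c : ℚ√5) (B : Mat n p) → A · (c • B) ≋ c • (A · B)
  ·-•ʳ A c B i j = trans (∑-cong (λ l → solve 3 (λ a c b → a :* (c :* b) := c :* (a :* b)) refl (A i l) c (B l j)))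
                         (∑-⊛ˡ c (λ l → A i l ⊛ B l j))

  •-·ˡ : ∀ {m n p} (c : ℚ√5) (A : Mat m n) (B : Mat n p) → (c • A) · B ≋ c • (A · B)
  •-·ˡ c A B i j = trans (∑-cong (λ l → ⊛-assoc c (A i l) (B l j))) (∑-⊛ˡ c (λ l → A i l ⊛ B l j))

  IsInverse⇒IsMoorePenroseInverse : ∀ {n} {A G : Mat n n} → IsInverse A G → IsMoorePenroseInverse A G
  IsInverse⇒IsMoorePenroseInverse {n} {A} {G} (AG≋I , GA≋I) =
    (λ i j → trans (·-congˡ A AG≋I i j) (·-identityˡ A i j)) ,
    (λ i j → trans (·-congˡ G GA≋I i j) (·-identityˡ G i j)) ,
    symmetric AG≋I ,
    symmetric GA≋I
    where
    symmetric : ∀ {M : Mat n n} → M ≋ Id n → (M ᵀ) ≋ M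
    symmetric M≋I i j = trans (M≋I j i) (trans (Id-sym j i) (sym (M≋I i j)))

  ∑-columnOf-· : ∀ {m n p} (A : Mat m n) (M : Mat n p) j →
                 ∑ (λ x → (A · M) x j) ≡ ∑ (λ l → ∑ (λ x → A x l) ⊛ M l j)
  ∑-columnOf-· A M j = trans (∑-comm (λ x l → A x l ⊛ M l j))
                             (∑-cong (λ l → ∑-⊛ʳ (M l j) (λ x → A x l)))

  ∑-rowOf-· : ∀ {m n p} (M : Mat m n) (A : Mat n p) i →
              ∑ (λ y → (M · A) i y) ≡ ∑ (λ l → M i l ⊛ ∑ (λ y → A l y))
  ∑-rowOf-· M A i = trans (∑-comm (λ y l → M i l ⊛ A l y))
                          (∑-cong (λ l → ∑-⊛ˡ (M i l) (λ y → A l y)))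

  ·-congʳ : ∀ {m n p} (A : Mat m n) {B B′ : Mat n p} → B ≋ B′ → A · B ≋ A · B′
  ·-congʳ A B≋B′ i j = ∑-cong (λ l → cong (A i l ⊛_) (B≋B′ l j))

module ConjugatePowers where
  open import Data.Integer as ℤ using (ℤ; +_; -[1+_])
  import Data.Integer.Properties as ℤP
  open import Data.Integer.Solver using (module +-*-Solver)
  open import Data.Nat as ℕ using (zero; _<_)
  import Data.Nat.Properties as ℕP
  open import Data.Product using (proj₁; proj₂)
  open import Data.Sum using (_⊎_; inj₁; inj₂; [_,_])
  import Data.Rational as Q
  import Data.Rational.Properties as QP
  open import Relation.Binary.PropositionalEquality hiding ([_])
  open QuadraticField
  open +-*-Solver using (solve; _:=_; con; _:+_; _:*_; :-_; _:-_)

  α β : ℚ√5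
  α = (⊝ ⟦ 3 ⟧) ⊕ √5
  β = (⊝ ⟦ 3 ⟧) ⊖ √5

  coordinates : ℕ → ℤ × ℤ
  coordinates zero    = + 1 , + 0
  coordinates (suc j) = -[1+ 2 ] ℤ.* p ℤ.+ + 5 ℤ.* q , p ℤ.+ -[1+ 2 ] ℤ.* q
    where
    p = proj₁ (coordinates j)
    q = proj₂ (coordinates j)

  p q : ℕ → ℤ
  p j = proj₁ (coordinates j)
  q j = proj₂ (coordinates j)

  α^≡ : ∀ j → α ^ j ≡ fromℤ (p j) + fromℤ (q j) √5
  α^≡ zero    = refl
  α^≡ (suc j) rewrite α^≡ j = trans (fromℤ-⊛ -[1+ 2 ] (+ 1) (p j) (q j))
    (cong₂ (λ u v → fromℤ u + fromℤ v √5)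
      (solve 2 (λ x y → con -[1+ 2 ] :* x :+ con (+ 5) :* (con (+ 1) :* y) := con -[1+ 2 ] :* x :+ con (+ 5) :* y)
             refl (p j) (q j))
      (solve 2 (λ x y → con -[1+ 2 ] :* y :+ con (+ 1) :* x := x :+ con -[1+ 2 ] :* y) refl (p j) (q j)))

  β^≡ : ∀ j → β ^ j ≡ fromℤ (p j) + fromℤ (ℤ.- q j) √5
  β^≡ zero    = refl
  β^≡ (suc j) rewrite β^≡ j = trans (fromℤ-⊛ -[1+ 2 ] -[1+ 0 ] (p j) (ℤ.- q j))
    (cong₂ (λ u v → fromℤ u + fromℤ v √5)
      (solve 2 (λ x y → con -[1+ 2 ] :* x :+ con (+ 5) :* (con -[1+ 0 ] :* (:- y)) := con -[1+ 2 ] :* x :+ con (+ 5) :* y)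
             refl (p j) (q j))
      (solve 2 (λ x y → con -[1+ 2 ] :* (:- y) :+ con -[1+ 0 ] :* x := :- (x :+ con -[1+ 2 ] :* y))
             refl (p j) (q j)))

  p²-5q²≡4^ : ∀ j → p j ℤ.* p j ℤ.- + 5 ℤ.* (q j ℤ.* q j) ≡ + (2 ℕ.^ j) ℤ.* + (2 ℕ.^ j)
  p²-5q²≡4^ zero    = refl
  p²-5q²≡4^ (suc j) = begin
    _ ≡⟨ solve 2 (λ x y → (con -[1+ 2 ] :* x :+ con (+ 5) :* y) :* (con -[1+ 2 ] :* x :+ con (+ 5) :* y)
                          :- con (+ 5) :* ((x :+ con -[1+ 2 ] :* y) :* (x :+ con -[1+ 2 ] :* y))
                          := con (+ 4) :* (x :* x :- con (+ 5) :* (y :* y))) refl (p j) (q j) ⟩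
    + 4 ℤ.* (p j ℤ.* p j ℤ.- + 5 ℤ.* (q j ℤ.* q j))   ≡⟨ cong (+ 4 ℤ.*_) (p²-5q²≡4^ j) ⟩
    + 4 ℤ.* (+ (2 ℕ.^ j) ℤ.* + (2 ℕ.^ j))              ≡⟨ solve 1 (λ t → con (+ 4) :* (t :* t) := (con (+ 2) :* t) :* (con (+ 2) :* t))
                                                                 refl (+ (2 ℕ.^ j)) ⟩
    (+ 2 ℤ.* + (2 ℕ.^ j)) ℤ.* (+ 2 ℤ.* + (2 ℕ.^ j))   ≡⟨ cong (λ u → u ℤ.* u) (sym (ℤP.pos-* 2 (2 ℕ.^ j))) ⟩
    + (2 ℕ.^ suc j) ℤ.* + (2 ℕ.^ suc j)               ∎
    where open ≡-Reasoning

  -- (P j, R j) are the coordinates of (-α)^j = (3 - √5)^j, so p j = (-1)^j P j with P j ≥ 2^j.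
  absCoordinates : ℕ → ℕ × ℕ
  absCoordinates zero    = 1 , 0
  absCoordinates (suc j) = 3 ℕ.* P ℕ.+ 5 ℕ.* R , P ℕ.+ 3 ℕ.* R
    where
    P = proj₁ (absCoordinates j)
    R = proj₂ (absCoordinates j)

  P R : ℕ → ℕ
  P j = proj₁ (absCoordinates j)
  R j = proj₂ (absCoordinates j)

  sign : ℕ → ℤ
  sign zero    = + 1
  sign (suc j) = ℤ.- sign j

  sign≡±1 : ∀ j → sign j ≡ + 1 ⊎ sign j ≡ -[1+ 0 ]
  sign≡±1 zero = inj₁ refl
  sign≡±1 (suc j) with sign≡±1 j
  ... | inj₁ s≡1  = inj₂ (cong ℤ.-_ s≡1)
  ... | inj₂ s≡-1 = inj₁ (cong ℤ.-_ s≡-1)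

  p≡sign*P : ∀ j → p j ≡ sign j ℤ.* + P j × q j ≡ ℤ.- (sign j ℤ.* + R j)
  p≡sign*P zero = refl , refl
  p≡sign*P (suc j) with p≡sign*P j
  ... | p≡ , q≡ =
    trans (cong₂ (λ u v → -[1+ 2 ] ℤ.* u ℤ.+ + 5 ℤ.* v) p≡ q≡)
      (trans (solve 3 (λ s x y → con -[1+ 2 ] :* (s :* x) :+ con (+ 5) :* (:- (s :* y))
                               := (:- s) :* (con (+ 3) :* x :+ con (+ 5) :* y)) refl (sign j) (+ P j) (+ R j))
        (cong (ℤ.- sign j ℤ.*_) (sym (trans (ℤP.pos-+ (3 ℕ.* P j) (5 ℕ.* R j))
                                           (cong₂ ℤ._+_ (ℤP.pos-* 3 (P j)) (ℤP.pos-* 5 (R j))))))) ,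
    trans (cong₂ (λ u v → u ℤ.+ -[1+ 2 ] ℤ.* v) p≡ q≡)
      (trans (solve 3 (λ s x y → s :* x :+ con -[1+ 2 ] :* (:- (s :* y))
                               := :- ((:- s) :* (x :+ con (+ 3) :* y))) refl (sign j) (+ P j) (+ R j))
        (cong (λ u → ℤ.- (ℤ.- sign j ℤ.* u)) (sym (trans (ℤP.pos-+ (P j) (3 ℕ.* R j))
                                                         (cong (λ u → + P j ℤ.+ u) (ℤP.pos-* 3 (R j)))))))

  2^≤P : ∀ j → 2 ℕ.^ j ≤ P j
  2^≤P zero    = s≤s z≤n
  2^≤P (suc j) = ℕP.≤-trans (ℕP.*-monoʳ-≤ 2 (2^≤P j))
    (ℕP.≤-trans (ℕP.*-monoˡ-≤ (P j) {2} {3} (s≤s (s≤s z≤n))) (ℕP.m≤m+n (3 ℕ.* P j) (5 ℕ.* R j)))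

  P>0 : ∀ j → 0 < P j
  P>0 j = ℕP.<-≤-trans (ℕP.m^n>0 2 j) (2^≤P j)

  2^<P : ∀ j → 2 ℕ.^ suc j < P (suc j)
  2^<P j = ℕP.≤-<-trans (ℕP.*-monoʳ-≤ 2 (2^≤P j))
    (ℕP.<-≤-trans (ℕP.m<n+m (2 ℕ.* P j) (P>0 j)) (ℕP.m≤m+n (3 ℕ.* P j) (5 ℕ.* R j)))

  p≢2^ : ∀ j → p (suc j) ≢ + (2 ℕ.^ suc j)
  p≢2^ j p≡2^ with sign≡±1 (suc j)
  ... | inj₁ s≡1 = ℕP.<-irrefl (sym (ℤP.+-injective (begin
    + P (suc j)               ≡⟨ sym (ℤP.*-identityˡ _) ⟩
    + 1 ℤ.* + P (suc j)       ≡⟨ cong (ℤ._* + P (suc j)) (sym s≡1) ⟩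
    sign (suc j) ℤ.* + P (suc j) ≡⟨ sym (proj₁ (p≡sign*P (suc j))) ⟩
    p (suc j)                 ≡⟨ p≡2^ ⟩
    + (2 ℕ.^ suc j)           ∎))) (2^<P j)
    where open ≡-Reasoning
  ... | inj₂ s≡-1 = negative≢positive (P>0 (suc j))
    (trans (cong (ℤ._* + P (suc j)) (sym s≡-1)) (trans (sym (proj₁ (p≡sign*P (suc j)))) p≡2^))
    where
    negative≢positive : ∀ {n m} → 0 < n → -[1+ 0 ] ℤ.* + n ≢ + m
    negative≢positive {suc n} _ ()

  norm-t-p : ∀ t p q → p ℤ.* p ℤ.- + 5 ℤ.* (q ℤ.* q) ≡ t ℤ.* t →
             (t ℤ.- p) ℤ.* (t ℤ.- p) ℤ.- + 5 ℤ.* (q ℤ.* q) ≡ (+ 2 ℤ.* t) ℤ.* (t ℤ.- p)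
  norm-t-p t p q norm≡t² = begin
    (t ℤ.- p) ℤ.* (t ℤ.- p) ℤ.- + 5 ℤ.* (q ℤ.* q)
      ≡⟨ solve 3 (λ t p q → (t :- p) :* (t :- p) :- con (+ 5) :* (q :* q)
                          := (t :* t :- con (+ 2) :* t :* p) :+ (p :* p :- con (+ 5) :* (q :* q))) refl t p q ⟩
    (t ℤ.* t ℤ.- + 2 ℤ.* t ℤ.* p) ℤ.+ (p ℤ.* p ℤ.- + 5 ℤ.* (q ℤ.* q))
      ≡⟨ cong (λ u → (t ℤ.* t ℤ.- + 2 ℤ.* t ℤ.* p) ℤ.+ u) norm≡t² ⟩
    (t ℤ.* t ℤ.- + 2 ℤ.* t ℤ.* p) ℤ.+ t ℤ.* t
      ≡⟨ solve 2 (λ t p → (t :* t :- con (+ 2) :* t :* p) :+ t :* t := (con (+ 2) :* t) :* (t :- p)) refl t p ⟩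
    (+ 2 ℤ.* t) ℤ.* (t ℤ.- p) ∎
    where open ≡-Reasoning

  2^-⊖-⊛-inverseʳ : ∀ j (y : ℤ) → y ℤ.* y ≡ q (suc j) ℤ.* q (suc j) →
                    let D = (⟦ 2 ⟧ ^ suc j) ⊖ (fromℤ (p (suc j)) + fromℤ y √5) in D ⊛ inv D ≡ 𝟙
  2^-⊖-⊛-inverseʳ j y y²≡q² = subst (λ D → D ⊛ inv D ≡ 𝟙) (sym D≡)
    (integral-⊛-inverseʳ (t ℤ.- p′) (ℤ.- y) λ N≡0 →
       [ 2t≢0 , t-p≢0 ] (ℤP.i*j≡0⇒i≡0∨j≡0 (+ 2 ℤ.* t) (trans (sym (norm-t-p t p′ (ℤ.- y) norm≡t²)) N≡0)))
    where
    t p′ : ℤ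
    t = + (2 ℕ.^ suc j)
    p′ = p (suc j)
    norm≡t² : p′ ℤ.* p′ ℤ.- + 5 ℤ.* ((ℤ.- y) ℤ.* (ℤ.- y)) ≡ t ℤ.* t
    norm≡t² = trans (cong (λ u → p′ ℤ.* p′ ℤ.- + 5 ℤ.* u)
                      (trans (solve 1 (λ y → (:- y) :* (:- y) := y :* y) refl y) y²≡q²))
                    (p²-5q²≡4^ (suc j))
    2t≢0 : + 2 ℤ.* t ≢ + 0
    2t≢0 2t≡0 = ℕP.<-irrefl (sym (ℤP.+-injective (trans (ℤP.pos-* 2 (2 ℕ.^ suc j)) 2t≡0))) (ℕP.m^n>0 2 (suc (suc j)))
    t-p≢0 : t ℤ.- p′ ≢ + 0
    t-p≢0 t-p≡0 = p≢2^ j (sym (ℤP.i-j≡0⇒i≡j t p′ t-p≡0))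
    D≡ : (⟦ 2 ⟧ ^ suc j) ⊖ (fromℤ p′ + fromℤ y √5) ≡ fromℤ (t ℤ.- p′) + fromℤ (ℤ.- y) √5
    D≡ = trans (cong (_⊖ (fromℤ p′ + fromℤ y √5)) (⟦⟧-^ 2 (suc j))) (+√5-cong
      (trans (cong (fromℤ t Q.+_) (fromℤ-neg p′)) (fromℤ-+ t (ℤ.- p′)))
      (trans (QP.+-identityˡ (Q.- fromℤ y)) (fromℤ-neg y)))

  2^-α^-⊛-inverseʳ : ∀ j → let D = (⟦ 2 ⟧ ^ suc j) ⊖ (α ^ suc j) in D ⊛ inv D ≡ 𝟙
  2^-α^-⊛-inverseʳ j = subst (λ x → let D = (⟦ 2 ⟧ ^ suc j) ⊖ x in D ⊛ inv D ≡ 𝟙) (sym (α^≡ (suc j)))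
    (2^-⊖-⊛-inverseʳ j (q (suc j)) refl)

  2^-β^-⊛-inverseʳ : ∀ j → let D = (⟦ 2 ⟧ ^ suc j) ⊖ (β ^ suc j) in D ⊛ inv D ≡ 𝟙
  2^-β^-⊛-inverseʳ j = subst (λ x → let D = (⟦ 2 ⟧ ^ suc j) ⊖ x in D ⊛ inv D ≡ 𝟙) (sym (β^≡ (suc j)))
    (2^-⊖-⊛-inverseʳ j (ℤ.- q (suc j)) (solve 1 (λ y → (:- y) :* (:- y) := y :* y) refl (q (suc j))))

module CyclicIndex (m : ℕ) where
  open import Data.Nat as ℕ using (_∸_; _%_; _<_)
  import Data.Nat.Properties as ℕP
  open import Data.Nat.DivMod using (_mod_; m<n⇒m%n≡m; %-distribˡ-+; m%n%n≡m%n; [m+n]%n≡m%n; n%n≡0)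
  open import Data.Nat.Solver using (module +-*-Solver)
  open import Data.Fin as F using (Fin; toℕ)
  import Data.Fin.Properties as FP
  open import Relation.Binary.PropositionalEquality
  open import Relation.Nullary using (yes; no)
  open import Data.Sum using (_⊎_; inj₁; inj₂)
  open +-*-Solver using (solve; _:=_; con; _:+_)

  K : ℕ
  K = suc (suc (suc m))

  infixl 6 _+ₖ_

  _+ₖ_ : Fin K → Fin K → Fin K
  i +ₖ e = (toℕ i ℕ.+ toℕ e) mod K

  -- circ K c i j reduces to c (offset i j)
  offset : Fin K → Fin K → Fin K
  offset i j = (toℕ j ℕ.+ (K ∸ toℕ i)) mod K

  one minusOne : Fin K
  one      = F.suc F.zero
  minusOne = F.fromℕ (suc (suc m))

  next prev : Fin K → Fin K
  next i = i +ₖ one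
  prev i = i +ₖ minusOne

  toℕ-mod : ∀ n → toℕ (n mod K) ≡ n % K
  toℕ-mod n = FP.toℕ-fromℕ< _

  toℕ%K : ∀ (a : Fin K) → toℕ a % K ≡ toℕ a
  toℕ%K a = m<n⇒m%n≡m (FP.toℕ<n a)

  %K-injective : ∀ {a b : Fin K} → toℕ a % K ≡ toℕ b % K → a ≡ b
  %K-injective {a} {b} eq = FP.toℕ-injective (trans (sym (toℕ%K a)) (trans eq (toℕ%K b)))

  toℕ-+ₖ : ∀ a e → toℕ (a +ₖ e) % K ≡ (toℕ a ℕ.+ toℕ e) % K
  toℕ-+ₖ a e = trans (toℕ%K (a +ₖ e)) (toℕ-mod (toℕ a ℕ.+ toℕ e))

  [m%K+n]%K≡[m+n]%K : ∀ a b → ((a % K) ℕ.+ b) % K ≡ (a ℕ.+ b) % K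
  [m%K+n]%K≡[m+n]%K a b = begin
    ((a % K) ℕ.+ b) % K           ≡⟨ %-distribˡ-+ (a % K) b K ⟩
    ((a % K % K) ℕ.+ (b % K)) % K ≡⟨ cong (λ u → (u ℕ.+ (b % K)) % K) (m%n%n≡m%n a K) ⟩
    ((a % K) ℕ.+ (b % K)) % K     ≡⟨ %-distribˡ-+ a b K ⟨
    (a ℕ.+ b) % K                 ∎
    where open ≡-Reasoning

  [m+n%K]%K≡[m+n]%K : ∀ a b → (a ℕ.+ (b % K)) % K ≡ (a ℕ.+ b) % K
  [m+n%K]%K≡[m+n]%K a b = begin
    (a ℕ.+ b % K) % K ≡⟨ cong (_% K) (ℕP.+-comm a (b % K)) ⟩
    (b % K ℕ.+ a) % K ≡⟨ [m%K+n]%K≡[m+n]%K b a ⟩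
    (b ℕ.+ a) % K     ≡⟨ cong (_% K) (ℕP.+-comm b a) ⟩
    (a ℕ.+ b) % K     ∎
    where open ≡-Reasoning

  toℕ+[K∸toℕ]≡K : ∀ (i : Fin K) → toℕ i ℕ.+ (K ∸ toℕ i) ≡ K
  toℕ+[K∸toℕ]≡K i = ℕP.m+[n∸m]≡n (ℕP.<⇒≤ (FP.toℕ<n i))

  +ₖ-assoc : ∀ a b c → (a +ₖ b) +ₖ c ≡ a +ₖ (b +ₖ c)
  +ₖ-assoc a b c = %K-injective (begin
    toℕ ((a +ₖ b) +ₖ c) % K                  ≡⟨ toℕ-+ₖ (a +ₖ b) c ⟩
    (toℕ (a +ₖ b) ℕ.+ toℕ c) % K             ≡⟨ cong (λ u → (u ℕ.+ toℕ c) % K) (toℕ-mod (toℕ a ℕ.+ toℕ b)) ⟩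
    ((toℕ a ℕ.+ toℕ b) % K ℕ.+ toℕ c) % K    ≡⟨ [m%K+n]%K≡[m+n]%K (toℕ a ℕ.+ toℕ b) (toℕ c) ⟩
    (toℕ a ℕ.+ toℕ b ℕ.+ toℕ c) % K          ≡⟨ cong (_% K) (ℕP.+-assoc (toℕ a) (toℕ b) (toℕ c)) ⟩
    (toℕ a ℕ.+ (toℕ b ℕ.+ toℕ c)) % K        ≡⟨ [m+n%K]%K≡[m+n]%K (toℕ a) (toℕ b ℕ.+ toℕ c) ⟨
    (toℕ a ℕ.+ (toℕ b ℕ.+ toℕ c) % K) % K    ≡⟨ cong (λ u → (toℕ a ℕ.+ u) % K) (toℕ-mod (toℕ b ℕ.+ toℕ c)) ⟨
    (toℕ a ℕ.+ toℕ (b +ₖ c)) % K             ≡⟨ toℕ-+ₖ a (b +ₖ c) ⟨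
    toℕ (a +ₖ (b +ₖ c)) % K                  ∎)
    where open ≡-Reasoning

  +ₖ-comm : ∀ a b → a +ₖ b ≡ b +ₖ a
  +ₖ-comm a b = %K-injective (trans (toℕ-+ₖ a b) (trans (cong (_% K) (ℕP.+-comm (toℕ a) (toℕ b))) (sym (toℕ-+ₖ b a))))

  +ₖ-identityʳ : ∀ a → a +ₖ F.zero ≡ a
  +ₖ-identityʳ a = %K-injective (trans (toℕ-+ₖ a F.zero) (cong (_% K) (ℕP.+-identityʳ (toℕ a))))

  +ₖ-identityˡ : ∀ a → F.zero +ₖ a ≡ a
  +ₖ-identityˡ a = trans (+ₖ-comm F.zero a) (+ₖ-identityʳ a)

  +ₖ-offset : ∀ i l → i +ₖ offset i l ≡ l
  +ₖ-offset i l = %K-injective (begin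
    toℕ (i +ₖ offset i l) % K                           ≡⟨ toℕ-+ₖ i (offset i l) ⟩
    (toℕ i ℕ.+ toℕ (offset i l)) % K                    ≡⟨ cong (λ u → (toℕ i ℕ.+ u) % K) (toℕ-mod (toℕ l ℕ.+ (K ∸ toℕ i))) ⟩
    (toℕ i ℕ.+ (toℕ l ℕ.+ (K ∸ toℕ i)) % K) % K         ≡⟨ [m+n%K]%K≡[m+n]%K (toℕ i) (toℕ l ℕ.+ (K ∸ toℕ i)) ⟩
    (toℕ i ℕ.+ (toℕ l ℕ.+ (K ∸ toℕ i))) % K             ≡⟨ cong (_% K) (solve 3 (λ i l d → i :+ (l :+ d) := l :+ (i :+ d))
                                                                refl (toℕ i) (toℕ l) (K ∸ toℕ i)) ⟩
    (toℕ l ℕ.+ (toℕ i ℕ.+ (K ∸ toℕ i))) % K             ≡⟨ cong (λ u → (toℕ l ℕ.+ u) % K) (toℕ+[K∸toℕ]≡K i) ⟩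
    (toℕ l ℕ.+ K) % K                                   ≡⟨ [m+n]%n≡m%n (toℕ l) K ⟩
    toℕ l % K                                           ∎)
    where open ≡-Reasoning

  offset-+ₖ : ∀ i e → offset i (i +ₖ e) ≡ e
  offset-+ₖ i e = %K-injective (begin
    toℕ (offset i (i +ₖ e)) % K                    ≡⟨ toℕ%K _ ⟩
    toℕ (offset i (i +ₖ e))                        ≡⟨ toℕ-mod (toℕ (i +ₖ e) ℕ.+ (K ∸ toℕ i)) ⟩
    (toℕ (i +ₖ e) ℕ.+ (K ∸ toℕ i)) % K             ≡⟨ cong (λ u → (u ℕ.+ (K ∸ toℕ i)) % K) (toℕ-mod (toℕ i ℕ.+ toℕ e)) ⟩
    ((toℕ i ℕ.+ toℕ e) % K ℕ.+ (K ∸ toℕ i)) % K    ≡⟨ [m%K+n]%K≡[m+n]%K (toℕ i ℕ.+ toℕ e) (K ∸ toℕ i) ⟩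
    (toℕ i ℕ.+ toℕ e ℕ.+ (K ∸ toℕ i)) % K          ≡⟨ cong (_% K) (solve 3 (λ i e d → i :+ e :+ d := e :+ (i :+ d))
                                                           refl (toℕ i) (toℕ e) (K ∸ toℕ i)) ⟩
    (toℕ e ℕ.+ (toℕ i ℕ.+ (K ∸ toℕ i))) % K        ≡⟨ cong (λ u → (toℕ e ℕ.+ u) % K) (toℕ+[K∸toℕ]≡K i) ⟩
    (toℕ e ℕ.+ K) % K                              ≡⟨ [m+n]%n≡m%n (toℕ e) K ⟩
    toℕ e % K                                      ∎)
    where open ≡-Reasoning

  offset≡⇒ : ∀ i l {e} → offset i l ≡ e → l ≡ i +ₖ e
  offset≡⇒ i l refl = sym (+ₖ-offset i l)

  offset-self : ∀ i → offset i i ≡ F.zero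
  offset-self i = trans (cong (offset i) (sym (+ₖ-identityʳ i))) (offset-+ₖ i F.zero)

  offset≡0⇒≡ : ∀ i j → offset i j ≡ F.zero → j ≡ i
  offset≡0⇒≡ i j eq = trans (offset≡⇒ i j eq) (+ₖ-identityʳ i)

  one+minusOne≡0 : one +ₖ minusOne ≡ F.zero
  one+minusOne≡0 = %K-injective (trans (toℕ-+ₖ one minusOne)
    (trans (cong (λ u → (1 ℕ.+ u) % K) (FP.toℕ-fromℕ (suc (suc m)))) (n%n≡0 K)))

  next-prev : ∀ a → next (prev a) ≡ a
  next-prev a = trans (+ₖ-assoc a minusOne one)
    (trans (cong (a +ₖ_) (trans (+ₖ-comm minusOne one) one+minusOne≡0)) (+ₖ-identityʳ a))

  offset-shift : ∀ i j {a b} → a +ₖ b ≡ F.zero → offset (i +ₖ a) j ≡ offset i j +ₖ b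
  offset-shift i j {a} {b} a+b≡0 = trans (cong (offset (i +ₖ a)) j≡) (offset-+ₖ (i +ₖ a) (offset i j +ₖ b))
    where
    j≡ : j ≡ (i +ₖ a) +ₖ (offset i j +ₖ b)
    j≡ = sym (begin
      (i +ₖ a) +ₖ (offset i j +ₖ b)  ≡⟨ +ₖ-assoc i a _ ⟩
      i +ₖ (a +ₖ (offset i j +ₖ b))  ≡⟨ cong (i +ₖ_) (trans (+ₖ-comm a _) (+ₖ-assoc (offset i j) b a)) ⟩
      i +ₖ (offset i j +ₖ (b +ₖ a))  ≡⟨ cong (λ u → i +ₖ (offset i j +ₖ u)) (trans (+ₖ-comm b a) a+b≡0) ⟩
      i +ₖ (offset i j +ₖ F.zero)    ≡⟨ cong (i +ₖ_) (+ₖ-identityʳ (offset i j)) ⟩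
      i +ₖ offset i j                ≡⟨ +ₖ-offset i j ⟩
      j                              ∎)
      where open ≡-Reasoning

  offset-nextˡ : ∀ i j → offset (next i) j ≡ prev (offset i j)
  offset-nextˡ i j = offset-shift i j one+minusOne≡0

  offset-prevˡ : ∀ i j → offset (prev i) j ≡ next (offset i j)
  offset-prevˡ i j = offset-shift i j (trans (+ₖ-comm minusOne one) one+minusOne≡0)

  offset-+ₖʳ : ∀ i j e → offset i (j +ₖ e) ≡ offset i j +ₖ e
  offset-+ₖʳ i j e = begin
    offset i (j +ₖ e)                ≡⟨ cong (λ x → offset i (x +ₖ e)) (+ₖ-offset i j) ⟨
    offset i (i +ₖ offset i j +ₖ e)  ≡⟨ cong (offset i) (+ₖ-assoc i (offset i j) e) ⟩
    offset i (i +ₖ (offset i j +ₖ e)) ≡⟨ offset-+ₖ i _ ⟩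
    offset i j +ₖ e                  ∎
    where open ≡-Reasoning

  offset-nextʳ : ∀ i j → offset i (next j) ≡ next (offset i j)
  offset-nextʳ i j = offset-+ₖʳ i j one

  offset-prevʳ : ∀ i j → offset i (prev j) ≡ prev (offset i j)
  offset-prevʳ i j = offset-+ₖʳ i j minusOne

  +ₖ-inverse-unique : ∀ a b c → a +ₖ b ≡ F.zero → a +ₖ c ≡ F.zero → b ≡ c
  +ₖ-inverse-unique a b c a+b≡0 a+c≡0 = begin
    b                ≡⟨ +ₖ-identityˡ b ⟨
    F.zero +ₖ b      ≡⟨ cong (_+ₖ b) (trans (+ₖ-comm c a) a+c≡0) ⟨
    (c +ₖ a) +ₖ b    ≡⟨ +ₖ-assoc c a b ⟩
    c +ₖ (a +ₖ b)    ≡⟨ cong (c +ₖ_) a+b≡0 ⟩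
    c +ₖ F.zero      ≡⟨ +ₖ-identityʳ c ⟩
    c                ∎
    where open ≡-Reasoning

  offset-+ₖ-offset : ∀ i j → offset j i +ₖ offset i j ≡ F.zero
  offset-+ₖ-offset i j = begin
    offset j i +ₖ offset i j                   ≡⟨ offset-+ₖ j _ ⟨
    offset j (j +ₖ (offset j i +ₖ offset i j)) ≡⟨ cong (offset j) (+ₖ-assoc j (offset j i) (offset i j)) ⟨
    offset j (j +ₖ offset j i +ₖ offset i j)   ≡⟨ cong (λ x → offset j (x +ₖ offset i j)) (+ₖ-offset j i) ⟩
    offset j (i +ₖ offset i j)                 ≡⟨ cong (offset j) (+ₖ-offset i j) ⟩
    offset j j                                 ≡⟨ offset-self j ⟩
    F.zero                                     ∎
    where open ≡-Reasoning

  offset-swap : ∀ i j {a b} → offset j i ≡ a → a +ₖ b ≡ F.zero → offset i j ≡ b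
  offset-swap i j {b = b} refl a+b≡0 = +ₖ-inverse-unique (offset j i) (offset i j) b (offset-+ₖ-offset i j) a+b≡0

  minusOne+one≡0 : minusOne +ₖ one ≡ F.zero
  minusOne+one≡0 = trans (+ₖ-comm minusOne one) one+minusOne≡0

  offset≡one⇒≡prev : ∀ l j → offset l j ≡ one → l ≡ prev j
  offset≡one⇒≡prev l j eq = offset≡⇒ j l (offset-swap j l eq one+minusOne≡0)

  offset≡minusOne⇒≡next : ∀ l j → offset l j ≡ minusOne → l ≡ next j
  offset≡minusOne⇒≡next l j eq = offset≡⇒ j l (offset-swap j l eq minusOne+one≡0)

  0≢one : F.zero ≢ one
  0≢one ()

  0≢minusOne : F.zero ≢ minusOne
  0≢minusOne ()

  one≢minusOne : one ≢ minusOne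
  one≢minusOne ()

  ≢next : ∀ i → i ≢ next i
  ≢next i i≡next = 0≢one (trans (sym (offset-self i)) (trans (cong (offset i) i≡next) (offset-+ₖ i one)))

  ≢prev : ∀ i → i ≢ prev i
  ≢prev i i≡prev = 0≢minusOne (trans (sym (offset-self i)) (trans (cong (offset i) i≡prev) (offset-+ₖ i minusOne)))

  next≢prev : ∀ i → next i ≢ prev i
  next≢prev i eq = one≢minusOne (trans (sym (offset-+ₖ i one)) (trans (cong (offset i) eq) (offset-+ₖ i minusOne)))

  toℕ≡⇒≡minusOne : ∀ {e} → toℕ e ≡ suc (suc m) → e ≡ minusOne
  toℕ≡⇒≡minusOne e≡ = FP.toℕ-injective (trans e≡ (sym (FP.toℕ-fromℕ (suc (suc m)))))

  prev-0 : prev F.zero ≡ minusOne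
  prev-0 = +ₖ-identityˡ minusOne

  prev-one : prev one ≡ F.zero
  prev-one = one+minusOne≡0

  next-minusOne : next minusOne ≡ F.zero
  next-minusOne = minusOne+one≡0

  prev-injective : ∀ {a b} → prev a ≡ prev b → a ≡ b
  prev-injective {a} {b} eq = trans (sym (next-prev a)) (trans (cong next eq) (next-prev b))

  toℕ-prev-suc : ∀ (e : Fin (suc (suc m))) → toℕ (prev (F.suc e)) ≡ toℕ e
  toℕ-prev-suc e = begin
    toℕ (prev (F.suc e))                    ≡⟨ toℕ-mod (suc (toℕ e) ℕ.+ toℕ minusOne) ⟩
    (suc (toℕ e) ℕ.+ toℕ minusOne) % K      ≡⟨ cong (λ u → (suc (toℕ e) ℕ.+ u) % K) (FP.toℕ-fromℕ (suc (suc m))) ⟩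
    (suc (toℕ e) ℕ.+ suc (suc m)) % K       ≡⟨ cong (_% K) (solve 2 (λ t m → (con 1 :+ t) :+ (con 2 :+ m) := t :+ (con 3 :+ m))
                                                    refl (toℕ e) m) ⟩
    (toℕ e ℕ.+ K) % K                       ≡⟨ [m+n]%n≡m%n (toℕ e) K ⟩
    toℕ e % K                               ≡⟨ m<n⇒m%n≡m (ℕP.<-trans (FP.toℕ<n e) (ℕP.n<1+n _)) ⟩
    toℕ e                                   ∎
    where open ≡-Reasoning

  toℕ-next : ∀ e → suc (toℕ e) < K → toℕ (next e) ≡ suc (toℕ e)
  toℕ-next e 1+e<K = trans (toℕ-mod (toℕ e ℕ.+ 1)) (trans (cong (_% K) (ℕP.+-comm (toℕ e) 1)) (m<n⇒m%n≡m 1+e<K))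

  toℕ-next-or-wraps : ∀ e → toℕ (next e) ≡ suc (toℕ e) ⊎ suc (toℕ e) ≡ K
  toℕ-next-or-wraps e with suc (toℕ e) ℕ.<? K
  ... | yes 1+e<K = inj₁ (toℕ-next e 1+e<K)
  ... | no  1+e≮K = inj₂ (ℕP.≤∧≮⇒≡ (FP.toℕ<n e) 1+e≮K)

module TridiagonalCirculant (m : ℕ) where
  import Data.Nat as ℕ
  open import Data.Empty using (⊥-elim)
  open import Data.Fin as F using (Fin; toℕ)
  import Data.Fin.Properties as FP
  open import Function using (_∘_)
  open import Relation.Binary.PropositionalEquality hiding (J)
  open import Relation.Nullary using (yes; no)
  open QuadraticField
  open FiniteSums
  open CyclicIndex m
  open ℚ√5-Solver using (solve; _:=_; con; _:+_; _:*_)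

  Tridiagonal : (Fin K → ℚ√5) → Set
  Tridiagonal c = ∀ e → e ≢ F.zero → e ≢ one → e ≢ minusOne → c e ≡ 𝟘

  ∑-circ-⊛ : ∀ c → Tridiagonal c → ∀ (g : Fin K → ℚ√5) i →
             ∑ (λ l → circ K c i l ⊛ g l) ≡ c F.zero ⊛ g i ⊕ c one ⊛ g (next i) ⊕ c minusOne ⊛ g (prev i)
  ∑-circ-⊛ c tridiagonal g i = trans
    (∑-support₃ i (next i) (prev i) _ (≢next i) (≢prev i) (next≢prev i) vanish)
    (cong₂ _⊕_ (cong₂ _⊕_ (cong (λ e → c e ⊛ g i) (offset-self i))
                          (cong (λ e → c e ⊛ g (next i)) (offset-+ₖ i one)))
               (cong (λ e → c e ⊛ g (prev i)) (offset-+ₖ i minusOne)))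
    where
    vanish : ∀ l → l ≢ i → l ≢ next i → l ≢ prev i → c (offset i l) ⊛ g l ≡ 𝟘
    vanish l l≢i l≢next l≢prev = trans
      (cong (_⊛ g l) (tridiagonal (offset i l) (l≢i ∘ offset≡0⇒≡ i l)
                                  (l≢next ∘ offset≡⇒ i l) (l≢prev ∘ offset≡⇒ i l)))
      (trans (⊛-comm 𝟘 (g l)) (⊛-zeroʳ (g l)))

  ∑-⊛-circ : ∀ c → Tridiagonal c → ∀ (g : Fin K → ℚ√5) j →
             ∑ (λ l → g l ⊛ circ K c l j) ≡ g j ⊛ c F.zero ⊕ g (prev j) ⊛ c one ⊕ g (next j) ⊛ c minusOne
  ∑-⊛-circ c tridiagonal g j = trans
    (∑-support₃ j (prev j) (next j) _ (≢prev j) (≢next j) (next≢prev j ∘ sym) vanish)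
    (cong₂ _⊕_ (cong₂ _⊕_ (cong (λ e → g j ⊛ c e) (offset-self j))
                          (cong (λ l → g (prev j) ⊛ c l) (offset-swap (prev j) j (offset-+ₖ j minusOne) minusOne+one≡0)))
               (cong (λ l → g (next j) ⊛ c l) (offset-swap (next j) j (offset-+ₖ j one) one+minusOne≡0)))
    where
    vanish : ∀ l → l ≢ j → l ≢ prev j → l ≢ next j → g l ⊛ c (offset l j) ≡ 𝟘
    vanish l l≢j l≢prev l≢next = trans
      (cong (g l ⊛_) (tridiagonal (offset l j) (l≢j ∘ sym ∘ offset≡0⇒≡ l j)
                                  (l≢prev ∘ offset≡one⇒≡prev l j) (l≢next ∘ offset≡minusOne⇒≡next l j)))
      (⊛-zeroʳ (g l))

  cB-tridiagonal : Tridiagonal (cB K)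
  cB-tridiagonal e e≢0 e≢1 e≢-1 with toℕ e ℕ.≟ 0
  ... | yes e≡0 = ⊥-elim (e≢0 (FP.toℕ-injective e≡0))
  ... | no _ with toℕ e ℕ.≟ 1
  ...   | yes e≡1 = ⊥-elim (e≢1 (FP.toℕ-injective e≡1))
  ...   | no _ with toℕ e ℕ.≟ suc (suc m)
  ...     | yes e≡-1 = ⊥-elim (e≢-1 (toℕ≡⇒≡minusOne e≡-1))
  ...     | no _     = refl

  cC-vanish : ∀ e → e ≢ F.zero → e ≢ minusOne → cC K e ≡ 𝟘
  cC-vanish e e≢0 e≢-1 with toℕ e ℕ.≟ 0
  ... | yes e≡0 = ⊥-elim (e≢0 (FP.toℕ-injective e≡0))
  ... | no _ with toℕ e ℕ.≟ suc (suc m)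
  ...   | yes e≡-1 = ⊥-elim (e≢-1 (toℕ≡⇒≡minusOne e≡-1))
  ...   | no _     = refl

  cC-tridiagonal : Tridiagonal (cC K)
  cC-tridiagonal e e≢0 _ e≢-1 = cC-vanish e e≢0 e≢-1

  cB-minusOne : cB K minusOne ≡ 𝟙
  cB-minusOne with toℕ minusOne ℕ.≟ 0
  ... | yes ()
  ... | no _ with toℕ minusOne ℕ.≟ 1
  ...   | yes ()
  ...   | no _ with toℕ minusOne ℕ.≟ suc (suc m)
  ...     | yes _   = refl
  ...     | no ≢-1  = ⊥-elim (≢-1 (FP.toℕ-fromℕ (suc (suc m))))

  cC-minusOne : cC K minusOne ≡ 𝟙
  cC-minusOne with toℕ minusOne ℕ.≟ 0
  ... | yes ()
  ... | no _ with toℕ minusOne ℕ.≟ suc (suc m)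
  ...   | yes _   = refl
  ...   | no ≢-1  = ⊥-elim (≢-1 (FP.toℕ-fromℕ (suc (suc m))))

  Id-offset : ∀ i j → Id K F.zero (offset i j) ≡ Id K i j
  Id-offset i j with i FP.≟ j
  ... | yes refl = trans (Id-≡ (sym (offset-self i))) (sym (Id-≡ {i = i} refl))
  ... | no i≢j   = trans (Id-≢ (λ 0≡offset → i≢j (sym (offset≡0⇒≡ i j (sym 0≡offset))))) (sym (Id-≢ i≢j))

  -- With e = offset j i, (C Cᵀ)ᵢⱼ = cC e + cC (e - 1) while Bᵢⱼ = cB (-e).
  cC-cB : ∀ e e′ → e +ₖ e′ ≡ F.zero → cC K e ⊕ cC K (prev e) ⊕ Id K F.zero e ≡ cB K e′
  cC-cB e e′ e+e′≡0 with e FP.≟ F.zero | e FP.≟ one | e FP.≟ minusOne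
  ... | yes refl | _ | _ =
    trans (cong₂ (λ x y → 𝟙 ⊕ cC K x ⊕ y) prev-0 (Id-≡ {K} {F.zero} {F.zero} refl))
          (trans (cong (λ x → 𝟙 ⊕ x ⊕ 𝟙) cC-minusOne)
                 (cong (cB K) (+ₖ-inverse-unique F.zero F.zero e′ refl e+e′≡0)))
  ... | no _ | yes refl | _ =
    trans (cong₂ (λ x y → 𝟘 ⊕ cC K x ⊕ y) prev-one (Id-≢ 0≢one))
          (trans (sym cB-minusOne) (cong (cB K) (+ₖ-inverse-unique one minusOne e′ one+minusOne≡0 e+e′≡0)))
  ... | no _ | no _ | yes refl =
    trans (cong₂ _⊕_ (cong₂ _⊕_ cC-minusOne (cC-vanish (prev minusOne) prev≢0 (≢prev minusOne ∘ sym))) (Id-≢ 0≢minusOne))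
          (cong (cB K) (+ₖ-inverse-unique minusOne one e′ minusOne+one≡0 e+e′≡0))
    where
    prev≢0 : prev minusOne ≢ F.zero
    prev≢0 eq = one≢minusOne (prev-injective (trans prev-one (sym eq)))
  ... | no e≢0 | no e≢1 | no e≢-1 =
    trans (cong₂ _⊕_ (cong₂ _⊕_ (cC-vanish e e≢0 e≢-1) (cC-vanish (prev e) prev≢0 prev≢-1)) (Id-≢ (e≢0 ∘ sym)))
          (sym (cB-tridiagonal e′ (λ e′≡0 → e≢0 (inverse e′≡0 refl))
                                 (λ e′≡1 → e≢-1 (inverse e′≡1 one+minusOne≡0))
                                 (λ e′≡-1 → e≢1 (inverse e′≡-1 minusOne+one≡0))))
    where
    prev≢0 : prev e ≢ F.zero
    prev≢0 eq = e≢1 (prev-injective (trans eq (sym prev-one)))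
    prev≢-1 : prev e ≢ minusOne
    prev≢-1 eq = e≢0 (prev-injective (trans eq (sym prev-0)))
    inverse : ∀ {a b} → e′ ≡ a → a +ₖ b ≡ F.zero → e ≡ b
    inverse {a} {b} refl a+b≡0 = +ₖ-inverse-unique a e b (trans (+ₖ-comm a e) e+e′≡0) a+b≡0

  CCᵀ+I≋B : (circ K (cC K) · (circ K (cC K) ᵀ)) ⊞ Id K ≋ circ K (cB K)
  CCᵀ+I≋B i j = begin
    ∑ (λ l → C i l ⊛ C j l) ⊕ Id K i j
      ≡⟨ cong (_⊕ Id K i j) (∑-circ-⊛ (cC K) cC-tridiagonal (C j) i) ⟩
    𝟙 ⊛ cC K e ⊕ 𝟘 ⊛ C j (next i) ⊕ cC K minusOne ⊛ cC K (offset j (prev i)) ⊕ Id K i j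
      ≡⟨ cong₂ (λ x y → 𝟙 ⊛ cC K e ⊕ 𝟘 ⊛ C j (next i) ⊕ x ⊛ cC K y ⊕ Id K i j) cC-minusOne (offset-prevʳ j i) ⟩
    𝟙 ⊛ cC K e ⊕ 𝟘 ⊛ C j (next i) ⊕ 𝟙 ⊛ cC K (prev e) ⊕ Id K i j
      ≡⟨ cong (𝟙 ⊛ cC K e ⊕ 𝟘 ⊛ C j (next i) ⊕ 𝟙 ⊛ cC K (prev e) ⊕_) (sym (trans (Id-offset j i) (Id-sym j i))) ⟩
    𝟙 ⊛ cC K e ⊕ 𝟘 ⊛ C j (next i) ⊕ 𝟙 ⊛ cC K (prev e) ⊕ Id K F.zero e
      ≡⟨ solve 4 (λ a b c d → con 𝟙 :* a :+ con 𝟘 :* b :+ con 𝟙 :* c :+ d := a :+ c :+ d) refl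
                 (cC K e) (C j (next i)) (cC K (prev e)) (Id K F.zero e) ⟩
    cC K e ⊕ cC K (prev e) ⊕ Id K F.zero e
      ≡⟨ cC-cB e (offset i j) (offset-+ₖ-offset i j) ⟩
    cB K (offset i j) ∎
    where
    open ≡-Reasoning
    C = circ K (cC K)
    e = offset j i

module Coefficients (m : ℕ) where
  open import Data.Nat using (_∸_)
  import Data.Nat.Properties as ℕP
  open import Data.Fin as F using (Fin; toℕ)
  import Data.Fin.Properties as FP
  open import Relation.Binary.PropositionalEquality hiding (J)
  open import Data.Sum using ([_,_]′)
  open import Function using (_∘_)
  open QuadraticField
  open FiniteSums
  open ConjugatePowers
  open CyclicIndex m
  open TridiagonalCirculant m
  open ℚ√5-Solver using (solve; _:=_; con; _:+_; _:*_; :-_; _:-_)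

  n : ℕ
  n = suc K

  c₀ w uα uβ : ℚ√5
  c₀ = ⊝ (⟦ 2 ⟧ ⊘ ⟦ 5 ⟧)
  w  = inv √5
  uα = inv ((⟦ 2 ⟧ ^ K) ⊖ (α ^ K))
  uβ = inv ((⟦ 2 ⟧ ^ K) ⊖ (β ^ K))

  -- b j = bTerm (n ∸ j) j; decoupling the exponent of 2 from j keeps the recurrence free of truncated subtraction.
  bTerm : ℕ → ℕ → ℚ√5
  bTerm e j = c₀ ⊕ ((⟦ 2 ⟧ ^ e) ⊛ ⟦ K ⟧ ⊛ w) ⊛ (((α ^ j) ⊛ uα) ⊖ ((β ^ j) ⊛ uβ))

  -- α/2 and β/2 are the roots of x² + 3x + 1, and c₀ (1 + 3 + 1) = -2.
  bTerm-recurrence : ∀ r j → bTerm (suc (suc r)) j ⊕ ⟦ 3 ⟧ ⊛ bTerm (suc r) (suc j) ⊕ bTerm r (suc (suc j)) ≡ ⊝ ⟦ 2 ⟧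
  bTerm-recurrence r j = solve 6 (λ Z A B k u v →
      (con c₀ :+ (con ⟦ 2 ⟧ :* (con ⟦ 2 ⟧ :* Z) :* k :* con w) :* ((A :* u) :- (B :* v)))
      :+ con ⟦ 3 ⟧ :* (con c₀ :+ (con ⟦ 2 ⟧ :* Z :* k :* con w) :* ((con α :* A :* u) :- (con β :* B :* v)))
      :+ (con c₀ :+ (Z :* k :* con w) :* ((con α :* (con α :* A) :* u) :- (con β :* (con β :* B) :* v)))
      := :- con ⟦ 2 ⟧) refl (⟦ 2 ⟧ ^ r) (α ^ j) (β ^ j) ⟦ K ⟧ uα uβ

  ≡-using-inverses : ∀ L R p q x y → x ≡ 𝟙 → y ≡ 𝟙 → L ≡ R ⊕ (p ⊛ (x ⊖ 𝟙) ⊕ q ⊛ (y ⊖ 𝟙)) → L ≡ R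
  ≡-using-inverses L R p q _ _ refl refl L≡ =
    trans L≡ (solve 3 (λ R p q → R :+ (p :* (con 𝟙 :- con 𝟙) :+ q :* (con 𝟙 :- con 𝟙)) := R) refl R p q)

  -- The denominators 2^K - α^K and 2^K - β^K make b periodic and produce the jump 2K at j = 0.
  bTerm-periodic : bTerm 1 K ≡ bTerm n 0
  bTerm-periodic = ≡-using-inverses (bTerm 1 K) (bTerm n 0) ((⟦ K ⟧ ⊛ w) ⊛ (⊝ ⟦ 2 ⟧)) ((⟦ K ⟧ ⊛ w) ⊛ ⟦ 2 ⟧)
    _ _ (2^-α^-⊛-inverseʳ (suc (suc m))) (2^-β^-⊛-inverseʳ (suc (suc m)))
    (solve 6 (λ Z A B k u v →
       con c₀ :+ (con ⟦ 2 ⟧ :* con 𝟙 :* k :* con w) :* ((con α :* A :* u) :- (con β :* B :* v))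
       := (con c₀ :+ (con ⟦ 2 ⟧ :* (con ⟦ 2 ⟧ :* Z) :* k :* con w) :* ((con 𝟙 :* u) :- (con 𝟙 :* v)))
          :+ ((k :* con w :* (:- con ⟦ 2 ⟧)) :* ((con ⟦ 2 ⟧ :* Z :- con α :* A) :* u :- con 𝟙)
             :+ (k :* con w :* con ⟦ 2 ⟧) :* ((con ⟦ 2 ⟧ :* Z :- con β :* B) :* v :- con 𝟙)))
       refl (⟦ 2 ⟧ ^ suc (suc m)) (α ^ suc (suc m)) (β ^ suc (suc m)) ⟦ K ⟧ uα uβ)

  bTerm-jump : bTerm 2 (suc (suc m)) ⊕ ⟦ 3 ⟧ ⊛ bTerm n 0 ⊕ bTerm K 1 ≡ ⟦ 2 ⟧ ⊛ ⟦ K ⟧ ⊖ ⟦ 2 ⟧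
  bTerm-jump = ≡-using-inverses _ (⟦ 2 ⟧ ⊛ ⟦ K ⟧ ⊖ ⟦ 2 ⟧) ((⟦ K ⟧ ⊛ w) ⊛ (⊝ β)) ((⟦ K ⟧ ⊛ w) ⊛ α)
    _ _ (2^-α^-⊛-inverseʳ (suc (suc m))) (2^-β^-⊛-inverseʳ (suc (suc m)))
    (solve 6 (λ Z A B k u v →
       (con c₀ :+ (con ⟦ 2 ⟧ :* (con ⟦ 2 ⟧ :* con 𝟙) :* k :* con w) :* ((A :* u) :- (B :* v)))
       :+ con ⟦ 3 ⟧ :* (con c₀ :+ (con ⟦ 2 ⟧ :* (con ⟦ 2 ⟧ :* Z) :* k :* con w) :* ((con 𝟙 :* u) :- (con 𝟙 :* v)))
       :+ (con c₀ :+ (con ⟦ 2 ⟧ :* Z :* k :* con w) :* ((con α :* con 𝟙 :* u) :- (con β :* con 𝟙 :* v)))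
       := (con ⟦ 2 ⟧ :* k :- con ⟦ 2 ⟧) :+ ((k :* con w :* (:- con β)) :* ((con ⟦ 2 ⟧ :* Z :- con α :* A) :* u :- con 𝟙)
                                     :+ (k :* con w :* con α) :* ((con ⟦ 2 ⟧ :* Z :- con β :* B) :* v :- con 𝟙)))
       refl (⟦ 2 ⟧ ^ suc (suc m)) (α ^ suc (suc m)) (β ^ suc (suc m)) ⟦ K ⟧ uα uβ)

  bₙ : ℕ → ℚ√5
  bₙ j = bTerm (n ∸ j) j

  bₙ-periodic : bₙ K ≡ bₙ 0
  bₙ-periodic = trans (cong (λ e → bTerm e K) (ℕP.m+n∸n≡m 1 K)) bTerm-periodic

  bₙ-recurrence : ∀ t → t ≤ suc (suc m) → bₙ t ⊕ ⟦ 3 ⟧ ⊛ bₙ (suc t) ⊕ bₙ (suc (suc t)) ≡ ⊝ ⟦ 2 ⟧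
  bₙ-recurrence t t≤2+m = trans
    (cong₂ (λ e e′ → bTerm e t ⊕ ⟦ 3 ⟧ ⊛ bTerm e′ (suc t) ⊕ bₙ (suc (suc t)))
           (ℕP.+-∸-assoc 2 t≤2+m) (ℕP.+-∸-assoc 1 t≤2+m))
    (bTerm-recurrence (suc (suc m) ∸ t) t)

  b : Fin K → ℚ√5
  b = bcoef K

  b-next : ∀ e → b (next e) ≡ bₙ (suc (toℕ e))
  b-next e = [ cong bₙ , wraps ]′ (toℕ-next-or-wraps e)
    where
    wraps : suc (toℕ e) ≡ K → b (next e) ≡ bₙ (suc (toℕ e))
    wraps 1+e≡K = begin
      b (next e)         ≡⟨ cong (b ∘ next) (toℕ≡⇒≡minusOne (ℕP.suc-injective 1+e≡K)) ⟩
      b (next minusOne)  ≡⟨ cong b next-minusOne ⟩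
      bₙ 0               ≡⟨ bₙ-periodic ⟨
      bₙ K               ≡⟨ cong bₙ 1+e≡K ⟨
      bₙ (suc (toℕ e))   ∎
      where open ≡-Reasoning

  b-recurrence : ∀ e → b (prev e) ⊕ ⟦ 3 ⟧ ⊛ b e ⊕ b (next e) ≡ (⟦ 2 ⟧ ⊛ ⟦ K ⟧) ⊛ Id K F.zero e ⊖ ⟦ 2 ⟧ ⊛ 𝟙
  b-recurrence F.zero = begin
    b (prev F.zero) ⊕ ⟦ 3 ⟧ ⊛ b F.zero ⊕ b (next F.zero)
      ≡⟨ cong (λ x → b x ⊕ ⟦ 3 ⟧ ⊛ b F.zero ⊕ b (next F.zero)) prev-0 ⟩
    bₙ (toℕ minusOne) ⊕ ⟦ 3 ⟧ ⊛ bₙ 0 ⊕ bₙ 1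
      ≡⟨ cong (λ j → bₙ j ⊕ ⟦ 3 ⟧ ⊛ bₙ 0 ⊕ bₙ 1) (FP.toℕ-fromℕ (suc (suc m))) ⟩
    bTerm (n ∸ suc (suc m)) (suc (suc m)) ⊕ ⟦ 3 ⟧ ⊛ bₙ 0 ⊕ bₙ 1
      ≡⟨ cong (λ e → bTerm e (suc (suc m)) ⊕ ⟦ 3 ⟧ ⊛ bₙ 0 ⊕ bₙ 1) (ℕP.m+n∸n≡m 2 (suc (suc m))) ⟩
    bTerm 2 (suc (suc m)) ⊕ ⟦ 3 ⟧ ⊛ bTerm n 0 ⊕ bTerm K 1
      ≡⟨ bTerm-jump ⟩
    ⟦ 2 ⟧ ⊛ ⟦ K ⟧ ⊖ ⟦ 2 ⟧
      ≡⟨ solve 1 (λ k → con ⟦ 2 ⟧ :* k :- con ⟦ 2 ⟧ := (con ⟦ 2 ⟧ :* k) :* con 𝟙 :- con ⟦ 2 ⟧ :* con 𝟙) refl ⟦ K ⟧ ⟩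
    (⟦ 2 ⟧ ⊛ ⟦ K ⟧) ⊛ 𝟙 ⊖ ⟦ 2 ⟧ ⊛ 𝟙 ∎
    where open ≡-Reasoning
  b-recurrence (F.suc e) = begin
    b (prev (F.suc e)) ⊕ ⟦ 3 ⟧ ⊛ b (F.suc e) ⊕ b (next (F.suc e))
      ≡⟨ cong₂ (λ j x → bₙ j ⊕ ⟦ 3 ⟧ ⊛ b (F.suc e) ⊕ x) (toℕ-prev-suc e) (b-next (F.suc e)) ⟩
    bₙ (toℕ e) ⊕ ⟦ 3 ⟧ ⊛ bₙ (suc (toℕ e)) ⊕ bₙ (suc (suc (toℕ e)))
      ≡⟨ bₙ-recurrence (toℕ e) (ℕP.<⇒≤ (FP.toℕ<n e)) ⟩
    ⊝ ⟦ 2 ⟧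
      ≡⟨ solve 1 (λ k → :- con ⟦ 2 ⟧ := (con ⟦ 2 ⟧ :* k) :* con 𝟘 :- con ⟦ 2 ⟧ :* con 𝟙) refl ⟦ K ⟧ ⟩
    (⟦ 2 ⟧ ⊛ ⟦ K ⟧) ⊛ 𝟘 ⊖ ⟦ 2 ⟧ ⊛ 𝟙 ∎
    where open ≡-Reasoning

module CirculantRelations (m : ℕ) where
  open import Data.Fin as F using (Fin)
  open import Relation.Binary.PropositionalEquality hiding (J)
  open QuadraticField
  open FiniteSums
  open CyclicIndex m
  open TridiagonalCirculant m
  open Coefficients m using (b; b-recurrence)
  open ℚ√5-Solver using (solve; _:=_; con; _:+_; _:*_; :-_; _:-_)

  B X : Mat K K
  B = circ K (cB K)
  X = circ K (bcoef K)

  2k : ℚ√5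
  2k = ⟦ 2 ⟧ ⊛ ⟦ K ⟧

  2kI-2J : Mat K K
  2kI-2J = 2k • Id K ⊟ ⟦ 2 ⟧ • J K

  B·X≋2kI-2J : B · X ≋ 2kI-2J
  B·X≋2kI-2J i j = begin
    ∑ (λ l → B i l ⊛ X l j)
      ≡⟨ ∑-circ-⊛ (cB K) cB-tridiagonal (λ l → X l j) i ⟩
    ⟦ 3 ⟧ ⊛ b e ⊕ 𝟙 ⊛ b (offset (next i) j) ⊕ cB K minusOne ⊛ b (offset (prev i) j)
      ≡⟨ cong₂ (λ x y → ⟦ 3 ⟧ ⊛ b e ⊕ 𝟙 ⊛ b x ⊕ y) (offset-nextˡ i j) (cong₂ (λ c x → c ⊛ b x) cB-minusOne (offset-prevˡ i j)) ⟩
    ⟦ 3 ⟧ ⊛ b e ⊕ 𝟙 ⊛ b (prev e) ⊕ 𝟙 ⊛ b (next e)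
      ≡⟨ solve 3 (λ p x q → con ⟦ 3 ⟧ :* x :+ con 𝟙 :* p :+ con 𝟙 :* q := p :+ con ⟦ 3 ⟧ :* x :+ q) refl (b (prev e)) (b e) (b (next e)) ⟩
    b (prev e) ⊕ ⟦ 3 ⟧ ⊛ b e ⊕ b (next e)
      ≡⟨ b-recurrence e ⟩
    2k ⊛ Id K F.zero e ⊖ ⟦ 2 ⟧ ⊛ 𝟙
      ≡⟨ cong (λ δ → 2k ⊛ δ ⊖ ⟦ 2 ⟧ ⊛ 𝟙) (Id-offset i j) ⟩
    2kI-2J i j ∎
    where
    open ≡-Reasoning
    e = offset i j

  X·B≋2kI-2J : X · B ≋ 2kI-2J
  X·B≋2kI-2J i j = begin
    ∑ (λ l → X i l ⊛ B l j)
      ≡⟨ ∑-⊛-circ (cB K) cB-tridiagonal (X i) j ⟩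
    b e ⊛ ⟦ 3 ⟧ ⊕ b (offset i (prev j)) ⊛ 𝟙 ⊕ b (offset i (next j)) ⊛ cB K minusOne
      ≡⟨ cong₂ (λ x y → b e ⊛ ⟦ 3 ⟧ ⊕ b x ⊛ 𝟙 ⊕ y) (offset-prevʳ i j) (cong₂ (λ x c → b x ⊛ c) (offset-nextʳ i j) cB-minusOne) ⟩
    b e ⊛ ⟦ 3 ⟧ ⊕ b (prev e) ⊛ 𝟙 ⊕ b (next e) ⊛ 𝟙
      ≡⟨ solve 3 (λ p x q → x :* con ⟦ 3 ⟧ :+ p :* con 𝟙 :+ q :* con 𝟙 := p :+ con ⟦ 3 ⟧ :* x :+ q) refl (b (prev e)) (b e) (b (next e)) ⟩
    b (prev e) ⊕ ⟦ 3 ⟧ ⊛ b e ⊕ b (next e)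
      ≡⟨ b-recurrence e ⟩
    2k ⊛ Id K F.zero e ⊖ ⟦ 2 ⟧ ⊛ 𝟙
      ≡⟨ cong (λ δ → 2k ⊛ δ ⊖ ⟦ 2 ⟧ ⊛ 𝟙) (Id-offset i j) ⟩
    2kI-2J i j ∎
    where
    open ≡-Reasoning
    e = offset i j

  ∑-2kI-2J : ∀ (δ : Fin K → ℚ√5) → ∑ δ ≡ 𝟙 → ∑ (λ x → 2k ⊛ δ x ⊖ ⟦ 2 ⟧ ⊛ 𝟙) ≡ 𝟘
  ∑-2kI-2J δ ∑δ≡1 = begin
    ∑ (λ x → 2k ⊛ δ x ⊕ ⊝ (⟦ 2 ⟧ ⊛ 𝟙))
      ≡⟨ ∑-distrib-⊕ (λ x → 2k ⊛ δ x) (λ _ → ⊝ (⟦ 2 ⟧ ⊛ 𝟙)) ⟩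
    ∑ (λ x → 2k ⊛ δ x) ⊕ ∑ {K} (λ _ → ⊝ (⟦ 2 ⟧ ⊛ 𝟙))
      ≡⟨ cong₂ _⊕_ (trans (∑-⊛ˡ 2k δ) (cong (2k ⊛_) ∑δ≡1)) (∑-const K _) ⟩
    2k ⊛ 𝟙 ⊕ ⟦ K ⟧ ⊛ ⊝ (⟦ 2 ⟧ ⊛ 𝟙)
      ≡⟨ solve 1 (λ k → (con ⟦ 2 ⟧ :* k) :* con 𝟙 :+ k :* (:- (con ⟦ 2 ⟧ :* con 𝟙)) := con 𝟘) refl ⟦ K ⟧ ⟩
    𝟘 ∎
    where open ≡-Reasoning

  ∑-column-2kI-2J : ∀ j → ∑ (λ x → 2kI-2J x j) ≡ 𝟘
  ∑-column-2kI-2J j = ∑-2kI-2J (λ x → Id K x j) (trans (∑-cong (λ l → sym (⊛-identityˡ (Id K l j)))) (∑-⊛-Id j (λ _ → 𝟙)))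

  ∑-row-2kI-2J : ∀ i → ∑ (λ y → 2kI-2J i y) ≡ 𝟘
  ∑-row-2kI-2J i = ∑-2kI-2J (Id K i) (trans (∑-cong (λ l → sym (trans (⊛-comm (Id K i l) 𝟙) (⊛-identityˡ (Id K i l))))) (∑-Id-⊛ i (λ _ → 𝟙)))

  ∑-row-B : ∀ i → ∑ (λ l → B i l) ≡ ⟦ 5 ⟧
  ∑-row-B i = begin
    ∑ (λ l → B i l)
      ≡⟨ ∑-cong (λ l → sym (trans (⊛-comm (B i l) 𝟙) (⊛-identityˡ (B i l)))) ⟩
    ∑ (λ l → B i l ⊛ 𝟙)
      ≡⟨ ∑-circ-⊛ (cB K) cB-tridiagonal (λ _ → 𝟙) i ⟩
    ⟦ 3 ⟧ ⊛ 𝟙 ⊕ 𝟙 ⊛ 𝟙 ⊕ cB K minusOne ⊛ 𝟙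
      ≡⟨ cong (λ c → ⟦ 3 ⟧ ⊛ 𝟙 ⊕ 𝟙 ⊛ 𝟙 ⊕ c ⊛ 𝟙) cB-minusOne ⟩
    ⟦ 5 ⟧ ∎
    where open ≡-Reasoning

  ∑-column-B : ∀ j → ∑ (λ l → B l j) ≡ ⟦ 5 ⟧
  ∑-column-B j = begin
    ∑ (λ l → B l j)
      ≡⟨ ∑-cong (λ l → sym (⊛-identityˡ (B l j))) ⟩
    ∑ (λ l → 𝟙 ⊛ B l j)
      ≡⟨ ∑-⊛-circ (cB K) cB-tridiagonal (λ _ → 𝟙) j ⟩
    𝟙 ⊛ ⟦ 3 ⟧ ⊕ 𝟙 ⊛ 𝟙 ⊕ 𝟙 ⊛ cB K minusOne
      ≡⟨ cong (λ c → 𝟙 ⊛ ⟦ 3 ⟧ ⊕ 𝟙 ⊛ 𝟙 ⊕ 𝟙 ⊛ c) cB-minusOne ⟩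
    ⟦ 5 ⟧ ∎
    where open ≡-Reasoning

  ⟦5⟧⊛-cancel : ∀ s → ⟦ 5 ⟧ ⊛ s ≡ 𝟘 → s ≡ 𝟘
  ⟦5⟧⊛-cancel s 5s≡0 = begin
    s                          ≡⟨ solve 1 (λ s → s := con (inv ⟦ 5 ⟧) :* (con ⟦ 5 ⟧ :* s)) refl s ⟩
    inv ⟦ 5 ⟧ ⊛ (⟦ 5 ⟧ ⊛ s)    ≡⟨ cong (inv ⟦ 5 ⟧ ⊛_) 5s≡0 ⟩
    inv ⟦ 5 ⟧ ⊛ 𝟘              ≡⟨ ⊛-zeroʳ (inv ⟦ 5 ⟧) ⟩
    𝟘                          ∎
    where open ≡-Reasoning

  -- B has line sums 5, so the line sums of X are 1/5 of those of B X = X B, which vanish.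
  ∑-column-X : ∀ j → ∑ (λ l → X l j) ≡ 𝟘
  ∑-column-X j = ⟦5⟧⊛-cancel _ (begin
    ⟦ 5 ⟧ ⊛ ∑ (λ l → X l j)                 ≡⟨ ∑-⊛ˡ ⟦ 5 ⟧ (λ l → X l j) ⟨
    ∑ (λ l → ⟦ 5 ⟧ ⊛ X l j)                 ≡⟨ ∑-cong (λ l → cong (_⊛ X l j) (∑-column-B l)) ⟨
    ∑ (λ l → ∑ (λ x → B x l) ⊛ X l j)       ≡⟨ ∑-columnOf-· B X j ⟨
    ∑ (λ x → (B · X) x j)                   ≡⟨ ∑-cong (λ x → B·X≋2kI-2J x j) ⟩
    ∑ (λ x → 2kI-2J x j)                    ≡⟨ ∑-column-2kI-2J j ⟩
    𝟘                                       ∎)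
    where open ≡-Reasoning

  ∑-row-X : ∀ i → ∑ (λ l → X i l) ≡ 𝟘
  ∑-row-X i = ⟦5⟧⊛-cancel _ (begin
    ⟦ 5 ⟧ ⊛ ∑ (λ l → X i l)                 ≡⟨ ∑-⊛ˡ ⟦ 5 ⟧ (λ l → X i l) ⟨
    ∑ (λ l → ⟦ 5 ⟧ ⊛ X i l)                 ≡⟨ ∑-cong (λ l → trans (⊛-comm ⟦ 5 ⟧ (X i l)) (cong (X i l ⊛_) (sym (∑-row-B l)))) ⟩
    ∑ (λ l → X i l ⊛ ∑ (λ y → B l y))       ≡⟨ ∑-rowOf-· X B i ⟨
    ∑ (λ y → (X · B) i y)                   ≡⟨ ∑-cong (λ y → X·B≋2kI-2J i y) ⟩
    ∑ (λ y → 2kI-2J i y)                    ≡⟨ ∑-row-2kI-2J i ⟩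
    𝟘                                       ∎)
    where open ≡-Reasoning

module WheelInverses (m : ℕ) where
  import Data.Nat as ℕ
  open import Data.Fin as F using (Fin)
  open import Relation.Binary.PropositionalEquality hiding (J)
  open QuadraticField
  open FiniteSums
  open CyclicIndex m using (K)
  open TridiagonalCirculant m using (CCᵀ+I≋B)
  open CirculantRelations m
  open ℚ√5-Solver using (solve; _:=_; con; _:+_; _:*_; :-_; _:-_)

  κ : ℚ√5
  κ = 𝟙 ⊘ (⟦ 4 ⟧ ⊛ ⟦ K ⟧)

  κ⊛4k≡1 : κ ⊛ (⟦ 4 ⟧ ⊛ ⟦ K ⟧) ≡ 𝟙
  κ⊛4k≡1 = begin
    (𝟙 ⊛ inv 4k) ⊛ 4k            ≡⟨ solve 2 (λ x d → (con 𝟙 :* x) :* d := d :* x) refl (inv 4k) 4k ⟩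
    4k ⊛ inv 4k                  ≡⟨ cong (λ d → d ⊛ inv d) (⟦⟧-* 4 K) ⟨
    ⟦ 4 ℕ.* K ⟧ ⊛ inv ⟦ 4 ℕ.* K ⟧ ≡⟨ ⟦suc⟧-⊛-inverseʳ (ℕ.pred (4 ℕ.* K)) ⟩
    𝟙                            ∎
    where
    open ≡-Reasoning
    4k = ⟦ 4 ⟧ ⊛ ⟦ K ⟧

  ≡-by-κ : ∀ {L} x → L ≡ x ⊛ (κ ⊛ (⟦ 4 ⟧ ⊛ ⟦ K ⟧)) → L ≡ x
  ≡-by-κ x L≡ = trans L≡ (trans (cong (x ⊛_) κ⊛4k≡1) (solve 1 (λ x → x :* con 𝟙 := x) refl x))

  γ f : ℚ√5
  γ = ⟦ 2 ⟧ ⊛ κ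
  f = ⟦ 2 ⟧ ⊘ ⟦ 5 ⟧

  -- Y = (X + (2/5) J) / (2k): since B J = 5 J and B X = 2k I - 2 J, this inverts B.
  Y : Mat K K
  Y i j = γ ⊛ (X i j ⊕ f)

  γ⊛[2kI-2J+2J]≡I : ∀ i j → γ ⊛ 2kI-2J i j ⊕ (γ ⊛ f) ⊛ ⟦ 5 ⟧ ≡ Id K i j
  γ⊛[2kI-2J+2J]≡I i j = ≡-by-κ (Id K i j)
    (solve 3 (λ c k δ → (con ⟦ 2 ⟧ :* c) :* ((con ⟦ 2 ⟧ :* k) :* δ :- con ⟦ 2 ⟧ :* con 𝟙) :+ ((con ⟦ 2 ⟧ :* c) :* con f) :* con ⟦ 5 ⟧
                       := δ :* (c :* (con ⟦ 4 ⟧ :* k))) refl κ ⟦ K ⟧ (Id K i j))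

  B·Y≋I : B · Y ≋ Id K
  B·Y≋I i j = begin
    ∑ (λ l → B i l ⊛ Y l j)
      ≡⟨ ∑-cong (λ l → solve 4 (λ b g x f → b :* (g :* (x :+ f)) := g :* (b :* x) :+ (g :* f) :* b) refl (B i l) γ (X l j) f) ⟩
    ∑ (λ l → γ ⊛ (B i l ⊛ X l j) ⊕ (γ ⊛ f) ⊛ B i l)
      ≡⟨ ∑-distrib-⊕ (λ l → γ ⊛ (B i l ⊛ X l j)) (λ l → (γ ⊛ f) ⊛ B i l) ⟩
    ∑ (λ l → γ ⊛ (B i l ⊛ X l j)) ⊕ ∑ (λ l → (γ ⊛ f) ⊛ B i l)
      ≡⟨ cong₂ _⊕_ (trans (∑-⊛ˡ γ (λ l → B i l ⊛ X l j)) (cong (γ ⊛_) (B·X≋2kI-2J i j)))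
                   (trans (∑-⊛ˡ (γ ⊛ f) (B i)) (cong ((γ ⊛ f) ⊛_) (∑-row-B i))) ⟩
    γ ⊛ 2kI-2J i j ⊕ (γ ⊛ f) ⊛ ⟦ 5 ⟧
      ≡⟨ γ⊛[2kI-2J+2J]≡I i j ⟩
    Id K i j ∎
    where open ≡-Reasoning

  Y·B≋I : Y · B ≋ Id K
  Y·B≋I i j = begin
    ∑ (λ l → Y i l ⊛ B l j)
      ≡⟨ ∑-cong (λ l → solve 4 (λ b g x f → (g :* (x :+ f)) :* b := g :* (x :* b) :+ (g :* f) :* b) refl (B l j) γ (X i l) f) ⟩
    ∑ (λ l → γ ⊛ (X i l ⊛ B l j) ⊕ (γ ⊛ f) ⊛ B l j)
      ≡⟨ ∑-distrib-⊕ (λ l → γ ⊛ (X i l ⊛ B l j)) (λ l → (γ ⊛ f) ⊛ B l j) ⟩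
    ∑ (λ l → γ ⊛ (X i l ⊛ B l j)) ⊕ ∑ (λ l → (γ ⊛ f) ⊛ B l j)
      ≡⟨ cong₂ _⊕_ (trans (∑-⊛ˡ γ (λ l → X i l ⊛ B l j)) (cong (γ ⊛_) (X·B≋2kI-2J i j)))
                   (trans (∑-⊛ˡ (γ ⊛ f) (λ l → B l j)) (cong ((γ ⊛ f) ⊛_) (∑-column-B j))) ⟩
    γ ⊛ 2kI-2J i j ⊕ (γ ⊛ f) ⊛ ⟦ 5 ⟧
      ≡⟨ γ⊛[2kI-2J+2J]≡I i j ⟩
    Id K i j ∎
    where open ≡-Reasoning

  IsInverse-CCᵀ+I-Y : IsInverse ((circ K (cC K) · (circ K (cC K) ᵀ)) ⊞ Id K) Y
  IsInverse-CCᵀ+I-Y = (λ i j → trans (·-congˡ Y CCᵀ+I≋B i j) (B·Y≋I i j))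
                    , (λ i j → trans (·-congʳ Y CCᵀ+I≋B i j) (Y·B≋I i j))

  -- X J = 0, so 2 Y (k I - J) = (X + (2/5) J) (k I - J) / k = X.
  X≋2Y[kI-J] : X ≋ ⟦ 2 ⟧ • (Y · ((⟦ K ⟧ • Id K) ⊟ J K))
  X≋2Y[kI-J] i j = sym (begin
    ⟦ 2 ⟧ ⊛ ∑ (λ l → Y i l ⊛ (⟦ K ⟧ ⊛ Id K l j ⊖ 𝟙))
      ≡⟨ cong (⟦ 2 ⟧ ⊛_) (∑-cong (λ l → solve 5 (λ g x f k δ → (g :* (x :+ f)) :* (k :* δ :- con 𝟙)
                                                     := k :* ((g :* (x :+ f)) :* δ) :+ ((:- g) :* x :+ :- (g :* f)))
                                           refl γ (X i l) f ⟦ K ⟧ (Id K l j))) ⟩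
    ⟦ 2 ⟧ ⊛ ∑ (λ l → ⟦ K ⟧ ⊛ (Y i l ⊛ Id K l j) ⊕ ((⊝ γ) ⊛ X i l ⊕ ⊝ (γ ⊛ f)))
      ≡⟨ cong (⟦ 2 ⟧ ⊛_) (∑-distrib-⊕ (λ l → ⟦ K ⟧ ⊛ (Y i l ⊛ Id K l j)) (λ l → (⊝ γ) ⊛ X i l ⊕ ⊝ (γ ⊛ f))) ⟩
    ⟦ 2 ⟧ ⊛ (∑ (λ l → ⟦ K ⟧ ⊛ (Y i l ⊛ Id K l j)) ⊕ ∑ (λ l → (⊝ γ) ⊛ X i l ⊕ ⊝ (γ ⊛ f)))
      ≡⟨ cong₂ (λ a b → ⟦ 2 ⟧ ⊛ (a ⊕ b))
           (trans (∑-⊛ˡ ⟦ K ⟧ (λ l → Y i l ⊛ Id K l j)) (cong (⟦ K ⟧ ⊛_) (∑-⊛-Id j (Y i))))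
           (trans (∑-distrib-⊕ (λ l → (⊝ γ) ⊛ X i l) (λ _ → ⊝ (γ ⊛ f)))
                  (cong₂ _⊕_ (trans (∑-⊛ˡ (⊝ γ) (X i)) (cong ((⊝ γ) ⊛_) (∑-row-X i))) (∑-const K (⊝ (γ ⊛ f))))) ⟩
    ⟦ 2 ⟧ ⊛ (⟦ K ⟧ ⊛ Y i j ⊕ ((⊝ γ) ⊛ 𝟘 ⊕ ⟦ K ⟧ ⊛ (⊝ (γ ⊛ f))))
      ≡⟨ ≡-by-κ (X i j) (solve 3 (λ c k x → con ⟦ 2 ⟧ :* (k :* ((con ⟦ 2 ⟧ :* c) :* (x :+ con f))
                                               :+ ((:- (con ⟦ 2 ⟧ :* c)) :* con 𝟘 :+ k :* (:- ((con ⟦ 2 ⟧ :* c) :* con f))))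
                                           := x :* (c :* (con ⟦ 4 ⟧ :* k))) refl κ ⟦ K ⟧ (X i j)) ⟩
    X i j ∎)
    where open ≡-Reasoning

  Q P̂ : Mat (suc K) (suc K)
  Q = Qmat K
  P̂ = block ⟦ 5 ⟧ (λ _ → ⊝ 𝟙) (λ _ → ⊝ 𝟙) (J K ⊞ (⟦ 2 ⟧ • X))

  ∑-𝟙⊕2g : ∀ (g : Fin K → ℚ√5) → ∑ g ≡ 𝟘 → ∑ (λ l → 𝟙 ⊕ ⟦ 2 ⟧ ⊛ g l) ≡ ⟦ K ⟧
  ∑-𝟙⊕2g g ∑g≡0 = begin
    ∑ (λ l → 𝟙 ⊕ ⟦ 2 ⟧ ⊛ g l)    ≡⟨ ∑-distrib-⊕ (λ _ → 𝟙) (λ l → ⟦ 2 ⟧ ⊛ g l) ⟩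
    ∑ {K} (λ _ → 𝟙) ⊕ ∑ (λ l → ⟦ 2 ⟧ ⊛ g l)
      ≡⟨ cong₂ _⊕_ (∑-const K 𝟙) (trans (∑-⊛ˡ ⟦ 2 ⟧ g) (cong (⟦ 2 ⟧ ⊛_) ∑g≡0)) ⟩
    ⟦ K ⟧ ⊛ 𝟙 ⊕ ⟦ 2 ⟧ ⊛ 𝟘          ≡⟨ solve 1 (λ k → k :* con 𝟙 :+ con ⟦ 2 ⟧ :* con 𝟘 := k) refl ⟦ K ⟧ ⟩
    ⟦ K ⟧                         ∎
    where open ≡-Reasoning

  κ⊛[Q·P̂]≡I : ∀ i j → κ ⊛ (Q · P̂) i j ≡ Id (suc K) i j
  κ⊛[Q·P̂]≡I F.zero F.zero = ≡-by-κ 𝟙 (trans (cong (λ s → κ ⊛ (⟦ K ⟧ ⊛ ⟦ 5 ⟧ ⊕ s)) (∑-const K (𝟙 ⊛ ⊝ 𝟙)))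
    (solve 2 (λ c k → c :* (k :* con ⟦ 5 ⟧ :+ k :* (con 𝟙 :* :- con 𝟙)) := con 𝟙 :* (c :* (con ⟦ 4 ⟧ :* k))) refl κ ⟦ K ⟧))
  κ⊛[Q·P̂]≡I F.zero (F.suc j) = trans
    (cong (λ s → κ ⊛ (⟦ K ⟧ ⊛ (⊝ 𝟙) ⊕ s))
          (trans (∑-cong (λ l → ⊛-identityˡ (𝟙 ⊕ ⟦ 2 ⟧ ⊛ X l j))) (∑-𝟙⊕2g (λ l → X l j) (∑-column-X j))))
    (solve 2 (λ c k → c :* (k :* (:- con 𝟙) :+ k) := con 𝟘) refl κ ⟦ K ⟧)
  κ⊛[Q·P̂]≡I (F.suc i) F.zero = trans
    (cong (λ s → κ ⊛ (𝟙 ⊛ ⟦ 5 ⟧ ⊕ s)) (trans (∑-⊛ʳ (⊝ 𝟙) (B i)) (cong (_⊛ (⊝ 𝟙)) (∑-row-B i))))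
    (solve 1 (λ c → c :* (con 𝟙 :* con ⟦ 5 ⟧ :+ con ⟦ 5 ⟧ :* (:- con 𝟙)) := con 𝟘) refl κ)
  κ⊛[Q·P̂]≡I (F.suc i) (F.suc j) = ≡-by-κ (Id (suc K) (F.suc i) (F.suc j)) (begin
    κ ⊛ (𝟙 ⊛ (⊝ 𝟙) ⊕ ∑ (λ l → B i l ⊛ (𝟙 ⊕ ⟦ 2 ⟧ ⊛ X l j)))
      ≡⟨ cong (λ s → κ ⊛ (𝟙 ⊛ (⊝ 𝟙) ⊕ s)) (∑-cong (λ l → solve 2 (λ b x → b :* (con 𝟙 :+ con ⟦ 2 ⟧ :* x) := b :+ con ⟦ 2 ⟧ :* (b :* x)) refl (B i l) (X l j))) ⟩
    κ ⊛ (𝟙 ⊛ (⊝ 𝟙) ⊕ ∑ (λ l → B i l ⊕ ⟦ 2 ⟧ ⊛ (B i l ⊛ X l j)))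
      ≡⟨ cong (λ s → κ ⊛ (𝟙 ⊛ (⊝ 𝟙) ⊕ s)) (trans (∑-distrib-⊕ (B i) (λ l → ⟦ 2 ⟧ ⊛ (B i l ⊛ X l j)))
           (cong₂ _⊕_ (∑-row-B i) (trans (∑-⊛ˡ ⟦ 2 ⟧ (λ l → B i l ⊛ X l j)) (cong (⟦ 2 ⟧ ⊛_) (B·X≋2kI-2J i j))))) ⟩
    κ ⊛ (𝟙 ⊛ (⊝ 𝟙) ⊕ (⟦ 5 ⟧ ⊕ ⟦ 2 ⟧ ⊛ (2k ⊛ Id K i j ⊖ ⟦ 2 ⟧ ⊛ 𝟙)))
      ≡⟨ cong (λ δ → κ ⊛ (𝟙 ⊛ (⊝ 𝟙) ⊕ (⟦ 5 ⟧ ⊕ ⟦ 2 ⟧ ⊛ (2k ⊛ δ ⊖ ⟦ 2 ⟧ ⊛ 𝟙)))) (sym (Id-suc i j)) ⟩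
    κ ⊛ (𝟙 ⊛ (⊝ 𝟙) ⊕ (⟦ 5 ⟧ ⊕ ⟦ 2 ⟧ ⊛ (2k ⊛ δ ⊖ ⟦ 2 ⟧ ⊛ 𝟙)))
      ≡⟨ solve 3 (λ c k δ → c :* (con 𝟙 :* (:- con 𝟙) :+ (con ⟦ 5 ⟧ :+ con ⟦ 2 ⟧ :* ((con ⟦ 2 ⟧ :* k) :* δ :- con ⟦ 2 ⟧ :* con 𝟙)))
                           := δ :* (c :* (con ⟦ 4 ⟧ :* k))) refl κ ⟦ K ⟧ δ ⟩
    δ ⊛ (κ ⊛ (⟦ 4 ⟧ ⊛ ⟦ K ⟧)) ∎)
    where
    open ≡-Reasoning
    δ = Id (suc K) (F.suc i) (F.suc j)

  κ⊛[P̂·Q]≡I : ∀ i j → κ ⊛ (P̂ · Q) i j ≡ Id (suc K) i j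
  κ⊛[P̂·Q]≡I F.zero F.zero = ≡-by-κ 𝟙 (trans (cong (λ s → κ ⊛ (⟦ 5 ⟧ ⊛ ⟦ K ⟧ ⊕ s)) (∑-const K ((⊝ 𝟙) ⊛ 𝟙)))
    (solve 2 (λ c k → c :* (con ⟦ 5 ⟧ :* k :+ k :* ((:- con 𝟙) :* con 𝟙)) := con 𝟙 :* (c :* (con ⟦ 4 ⟧ :* k))) refl κ ⟦ K ⟧))
  κ⊛[P̂·Q]≡I F.zero (F.suc j) = trans
    (cong (λ s → κ ⊛ (⟦ 5 ⟧ ⊛ 𝟙 ⊕ s)) (trans (∑-⊛ˡ (⊝ 𝟙) (λ l → B l j)) (cong ((⊝ 𝟙) ⊛_) (∑-column-B j))))
    (solve 1 (λ c → c :* (con ⟦ 5 ⟧ :* con 𝟙 :+ (:- con 𝟙) :* con ⟦ 5 ⟧) := con 𝟘) refl κ)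
  κ⊛[P̂·Q]≡I (F.suc i) F.zero = trans
    (cong (λ s → κ ⊛ ((⊝ 𝟙) ⊛ ⟦ K ⟧ ⊕ s))
          (trans (∑-cong (λ l → trans (⊛-comm (𝟙 ⊕ ⟦ 2 ⟧ ⊛ X i l) 𝟙) (⊛-identityˡ (𝟙 ⊕ ⟦ 2 ⟧ ⊛ X i l))))
                 (∑-𝟙⊕2g (X i) (∑-row-X i))))
    (solve 2 (λ c k → c :* ((:- con 𝟙) :* k :+ k) := con 𝟘) refl κ ⟦ K ⟧)
  κ⊛[P̂·Q]≡I (F.suc i) (F.suc j) = ≡-by-κ (Id (suc K) (F.suc i) (F.suc j)) (begin
    κ ⊛ ((⊝ 𝟙) ⊛ 𝟙 ⊕ ∑ (λ l → (𝟙 ⊕ ⟦ 2 ⟧ ⊛ X i l) ⊛ B l j))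
      ≡⟨ cong (λ s → κ ⊛ ((⊝ 𝟙) ⊛ 𝟙 ⊕ s)) (∑-cong (λ l → solve 2 (λ b x → (con 𝟙 :+ con ⟦ 2 ⟧ :* x) :* b := b :+ con ⟦ 2 ⟧ :* (x :* b)) refl (B l j) (X i l))) ⟩
    κ ⊛ ((⊝ 𝟙) ⊛ 𝟙 ⊕ ∑ (λ l → B l j ⊕ ⟦ 2 ⟧ ⊛ (X i l ⊛ B l j)))
      ≡⟨ cong (λ s → κ ⊛ ((⊝ 𝟙) ⊛ 𝟙 ⊕ s)) (trans (∑-distrib-⊕ (λ l → B l j) (λ l → ⟦ 2 ⟧ ⊛ (X i l ⊛ B l j)))
           (cong₂ _⊕_ (∑-column-B j) (trans (∑-⊛ˡ ⟦ 2 ⟧ (λ l → X i l ⊛ B l j)) (cong (⟦ 2 ⟧ ⊛_) (X·B≋2kI-2J i j))))) ⟩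
    κ ⊛ ((⊝ 𝟙) ⊛ 𝟙 ⊕ (⟦ 5 ⟧ ⊕ ⟦ 2 ⟧ ⊛ (2k ⊛ Id K i j ⊖ ⟦ 2 ⟧ ⊛ 𝟙)))
      ≡⟨ cong (λ δ → κ ⊛ ((⊝ 𝟙) ⊛ 𝟙 ⊕ (⟦ 5 ⟧ ⊕ ⟦ 2 ⟧ ⊛ (2k ⊛ δ ⊖ ⟦ 2 ⟧ ⊛ 𝟙)))) (sym (Id-suc i j)) ⟩
    κ ⊛ ((⊝ 𝟙) ⊛ 𝟙 ⊕ (⟦ 5 ⟧ ⊕ ⟦ 2 ⟧ ⊛ (2k ⊛ δ ⊖ ⟦ 2 ⟧ ⊛ 𝟙)))
      ≡⟨ solve 3 (λ c k δ → c :* ((:- con 𝟙) :* con 𝟙 :+ (con ⟦ 5 ⟧ :+ con ⟦ 2 ⟧ :* ((con ⟦ 2 ⟧ :* k) :* δ :- con ⟦ 2 ⟧ :* con 𝟙)))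
                           := δ :* (c :* (con ⟦ 4 ⟧ :* k))) refl κ ⟦ K ⟧ δ ⟩
    δ ⊛ (κ ⊛ (⟦ 4 ⟧ ⊛ ⟦ K ⟧)) ∎)
    where
    open ≡-Reasoning
    δ = Id (suc K) (F.suc i) (F.suc j)

  IsInverse-Q-Qplus : IsInverse Q (Qplus K)
  IsInverse-Q-Qplus = (λ i j → trans (·-•ʳ Q κ P̂ i j) (κ⊛[Q·P̂]≡I i j))
                    , (λ i j → trans (•-·ˡ κ P̂ Q i j) (κ⊛[P̂·Q]≡I i j))

mainTheorem5 : (k : ℕ) → 3 ≤ k →
    IsMoorePenroseInverse (Qmat k) (Qplus k)
    × (Σ[ Y ∈ Mat k k ]
        (IsInverse ((circ k (cC k) · (circ k (cC k) ᵀ)) ⊞ Id k) Y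
         × (circ k (bcoef k) ≋ (⟦ 2 ⟧ • (Y · ((⟦ k ⟧ • Id k) ⊟ J k))))))
mainTheorem5 (suc (suc (suc m))) (s≤s (s≤s (s≤s z≤n))) =
  IsInverse⇒IsMoorePenroseInverse IsInverse-Q-Qplus , Y , IsInverse-CCᵀ+I-Y , X≋2Y[kI-J]
  where
  open FiniteSums using (IsInverse⇒IsMoorePenroseInverse)
  open WheelInverses m
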